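{- The pattern sets $\{123,231\}$ and $\{123,312\}$ are extendably Wilf-equivalent, i.e. $|\mathcal S_{d,c,r}(123,231)|=|\mathcal S_{d,c,r}(123,312)|$ for all $d,c,r\ge0$. Hence both are extendably symmetric, i.e. $|\mathcal S_{d,c,r}(\tau)|=|\mathcal S_{d,r,c}(\tau)|$ for $\tau$ either of these sets and all $d,c,r\ge0$.
   Context: The permutation matrix of $\sigma\in\mathcal S_n$ is the $n\times n$ $0$-$1$ matrix with a $1$ in position $(i,\sigma(i))$. A partial permutation is a rectangular $0$-$1$ matrix with at most one $1$ ("dot") in each row and column. $\mathcal S_{d,c,r}$ is the set of partial permutations with $d$ dots, $r$ empty rows and $c$ empty columns, so they have size $(d+r)\times(d+c)$. A permutation $\sigma\in\mathcal S_{d+c+r}$ extends $\rho$ if $\rho$ is the upper-left $(d+r)\times(d+c)$ submatrix of $\sigma$'s permutation matrix. $\sigma$ contains $\pi\in\mathcal S_m$ if the permutation matrix of $\pi$ is a submatrix of that of $\sigma$. For a set $\tau$ of patterns, $\mathcal S_{d,c,r}(\tau)$ is the set of $\rho\in\mathcal S_{d,c,r}$ having an extension that avoids all patterns in $\tau$. -}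

module Defs where

open import Data.Nat using (ℕ; zero; suc; _+_; _≤_; _≟_; _≤?_)
open import Data.Nat.Properties using (m≤m+n; +-monoˡ-≤)
open import Data.Bool using (Bool; true; false; if_then_else_)
import Data.Bool.Properties as BoolP
open import Data.Fin using (Fin; inject≤)
import Data.Fin as Fin
open import Data.Fin.Properties using (all?; any?)
open import Data.Fin.Subset using (Subset; Side; inside; outside)
open import Data.Fin.Subset.Properties using (anySubset?)
open import Data.Vec using (Vec; []; _∷_; lookup; tabulate; toList; transpose)
import Data.Vec as Vec
import Data.Vec.Properties as VecP
open import Data.List using (List; []; _∷_; map)
import Data.List.Properties as ListP
open import Data.List.Relation.Unary.All using (All) renaming (all? to allL?)
open import Data.Vec.Relation.Unary.All using () renaming (All to AllV; all? to allV?)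
open import Data.Product using (Σ; ∃; ∃-syntax; _×_; _,_)
open import Relation.Nullary using (¬_; Dec; yes; no)
open import Relation.Nullary.Decidable using (True; _×-dec_; ¬?; _→-dec_; map′)
open import Relation.Binary.PropositionalEquality using (_≡_)
open import Function.Bundles using (_↔_)

Matrix : ℕ → ℕ → Set
Matrix m n = Vec (Vec Bool n) m

entry : ∀ {m n} → Matrix m n → Fin m → Fin n → Bool
entry M i j = lookup (lookup M i) j

ones : ∀ {n} → Vec Bool n → ℕ
ones []           = 0
ones (true  ∷ v)  = suc (ones v)
ones (false ∷ v)  = ones v

emptyLines : ∀ {m n} → Vec (Vec Bool n) m → ℕ
emptyLines []       = 0
emptyLines (v ∷ vs) with ones v
... | zero  = suc (emptyLines vs)
... | suc _ = emptyLines vs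

totalOnes : ∀ {m n} → Matrix m n → ℕ
totalOnes []       = 0
totalOnes (v ∷ vs) = ones v + totalOnes vs

IsPartialPerm : ∀ {m n} → Matrix m n → Set
IsPartialPerm M = AllV (λ row → ones row ≤ 1) M × AllV (λ col → ones col ≤ 1) (transpose M)

IsInS : (d c r : ℕ) → Matrix (d + r) (d + c) → Set
IsInS d c r ρ = IsPartialPerm ρ
              × totalOnes ρ ≡ d
              × emptyLines ρ ≡ r
              × emptyLines (transpose ρ) ≡ c

-- Permutations of {0,…,N-1} in one-line notation: injective vectors.

IsPerm : ∀ {N} → Vec (Fin N) N → Set
IsPerm {N} σ = ∀ (i j : Fin N) → lookup σ i ≡ lookup σ j → i ≡ j

permMatrix : ∀ {N} → Vec (Fin N) N → Matrix N N
permMatrix σ = tabulate λ i → tabulate λ j → Relation.Nullary.Decidable.⌊ lookup σ i Fin.≟ j ⌋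
  where import Relation.Nullary.Decidable

rows≤ : ∀ d c r → d + r ≤ d + c + r
rows≤ d c r = +-monoˡ-≤ r (m≤m+n d c)

cols≤ : ∀ d c r → d + c ≤ d + c + r
cols≤ d c r = m≤m+n (d + c) r

upperLeft : ∀ d c r → Matrix (d + c + r) (d + c + r) → Matrix (d + r) (d + c)
upperLeft d c r M = tabulate λ i → tabulate λ j →
  entry M (inject≤ i (rows≤ d c r)) (inject≤ j (cols≤ d c r))

Extends : ∀ d c r → Vec (Fin (d + c + r)) (d + c + r) → Matrix (d + r) (d + c) → Set
Extends d c r σ ρ = upperLeft d c r (permMatrix σ) ≡ ρ

select : ∀ {A : Set} {n} → Subset n → Vec A n → List A
select []            []       = []
select (inside ∷ s)  (x ∷ xs) = x ∷ select s xs
select (outside ∷ s) (x ∷ xs) = select s xs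

submatrix : ∀ {N} → Subset N → Subset N → Matrix N N → List (List Bool)
submatrix R C M = map (select C) (select R M)

matrixList : ∀ {m n} → Matrix m n → List (List Bool)
matrixList M = map toList (toList M)

Contains : ∀ {N k} → Vec (Fin N) N → Vec (Fin k) k → Set
Contains {N} σ π = ∃[ R ] ∃[ C ] submatrix R C (permMatrix σ) ≡ matrixList (permMatrix π)

Pattern : Set
Pattern = Σ ℕ λ k → Vec (Fin k) k

Avoids : ∀ {N} → Vec (Fin N) N → List Pattern → Set
Avoids σ τ = All (λ { (k , π) → ¬ Contains σ π }) τ

HasAvoidingExtension : ∀ d c r → List Pattern → Matrix (d + r) (d + c) → Set
HasAvoidingExtension d c r τ ρ =
  ∃[ σ ] (IsPerm σ × Extends d c r σ ρ × Avoids σ τ)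

InSτ : ∀ d c r → List Pattern → Matrix (d + r) (d + c) → Set
InSτ d c r τ ρ = IsInS d c r ρ × HasAvoidingExtension d c r τ ρ

vecAny? : ∀ {N} k {P : Vec (Fin N) k → Set} → (∀ v → Dec (P v)) → Dec (∃ P)
vecAny? zero P? = map′ (λ p → [] , p) (λ { ([] , p) → p }) (P? [])
vecAny? (suc k) {P} P? =
  map′ (λ { (x , v , p) → x ∷ v , p }) (λ { (x ∷ v , p) → x , v , p })
       (any? λ x → vecAny? k (λ v → P? (x ∷ v)))

matrix-≟ : ∀ {m n} (A B : Matrix m n) → Dec (A ≡ B)
matrix-≟ = VecP.≡-dec (VecP.≡-dec BoolP._≟_)

IsInS? : ∀ d c r ρ → Dec (IsInS d c r ρ)
IsInS? d c r ρ =
  ((allV? (λ row → ones row ≤? 1) ρ ×-dec allV? (λ col → ones col ≤? 1) (transpose ρ))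
   ×-dec (totalOnes ρ ≟ d) ×-dec (emptyLines ρ ≟ r) ×-dec (emptyLines (transpose ρ) ≟ c))

IsPerm? : ∀ {N} (σ : Vec (Fin N) N) → Dec (IsPerm σ)
IsPerm? σ = all? λ i → all? λ j → (lookup σ i Fin.≟ lookup σ j) →-dec (i Fin.≟ j)

Contains? : ∀ {N k} (σ : Vec (Fin N) N) (π : Vec (Fin k) k) → Dec (Contains σ π)
Contains? σ π = anySubset? λ R → anySubset? λ C →
  ListP.≡-dec (ListP.≡-dec BoolP._≟_) (submatrix R C (permMatrix σ)) (matrixList (permMatrix π))

Avoids? : ∀ {N} (σ : Vec (Fin N) N) τ → Dec (Avoids σ τ)
Avoids? σ τ = allL? (λ { (k , π) → ¬? (Contains? σ π) }) τ

InSτ? : ∀ d c r τ ρ → Dec (InSτ d c r τ ρ)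
InSτ? d c r τ ρ = IsInS? d c r ρ ×-dec
  vecAny? (d + c + r) (λ σ → IsPerm? σ ×-dec matrix-≟ (upperLeft d c r (permMatrix σ)) ρ ×-dec Avoids? σ τ)

-- The set S_{d,c,r}(τ) as a type (True makes membership proof-irrelevant,
-- so elements correspond exactly to matrices ρ).  Equal cardinality of
-- two such finite sets is expressed by a bijection _↔_.

S : (d c r : ℕ) → List Pattern → Set
S d c r τ = Σ (Matrix (d + r) (d + c)) (λ ρ → True (InSτ? d c r τ ρ))

-- Patterns in one-line notation (0-indexed): 123, 231, 312

p123 p231 p312 : Pattern
p123 = 3 , (Fin.zero ∷ Fin.suc Fin.zero ∷ Fin.suc (Fin.suc Fin.zero) ∷ [])
p231 = 3 , (Fin.suc Fin.zero ∷ Fin.suc (Fin.suc Fin.zero) ∷ Fin.zero ∷ [])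
p312 = 3 , (Fin.suc (Fin.suc Fin.zero) ∷ Fin.zero ∷ Fin.suc Fin.zero ∷ [])

τ₁ τ₂ : List Pattern
τ₁ = p123 ∷ p231 ∷ []
τ₂ = p123 ∷ p312 ∷ []

-- Inverting a permutation transposes its corners and exchanges the patterns 231 and 312, so
-- S_{d,c,r}(123,312) ≅ S_{d,r,c}(123,231) and both statements reduce to the symmetry of
-- S_{d,c,r}(123,231) in c and r.  A {123,231}-avoider is made of three decreasing runs whose
-- values form three consecutive blocks, so the corner of such an extension is determined by
-- where the middle run starts and how long it is.  Normalising these two
-- numbers parametrises S_{d,c,r}(123,231) by a set of size 1 + dc + d(d-1)/2 + rd, which is
-- symmetric in c and r.  Counting dots shows that a permutation has its corner in S_{d,c,r}
-- exactly when its last c rows point into the first d + c columns.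

module Submission where

open import Defs
open import Data.Nat as ℕ using (ℕ; zero; suc; z≤n; s≤s; _<_; _≤_; _+_; _∸_; _*_)
open import Data.Nat.Properties
open import Data.Nat.Tactic.RingSolver using (solve-∀)
open import Data.Bool using (Bool; true; false; if_then_else_; not)
open import Data.Bool.Properties using (T-irrelevant)
open import Data.Maybe as Maybe using (Maybe; just; nothing; is-just)
open import Data.Fin as F using (Fin; toℕ; fromℕ<; inject≤)
import Data.Fin.Properties as FinP
open import Data.Fin.Permutation using (Permutation; permutation)
open import Data.Fin.Subset using (Subset; inside; outside)
open import Data.Vec as V using (Vec; []; _∷_; lookup; tabulate; transpose)
import Data.Vec.Properties as VecP
open import Data.Vec.Relation.Unary.All using () renaming (All to AllV)
import Data.Vec.Relation.Unary.All.Properties as AllVP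
open import Data.List as L using (List; []; _∷_)
import Data.List.Properties as ListP
open import Data.List.Relation.Unary.All using ([]; _∷_)
open import Data.List.Relation.Unary.Linked using (Linked; []; [-]; _∷_)
open import Data.Product using (Σ; ∃; _×_; _,_; proj₁; proj₂)
open import Data.Sum using (_⊎_; inj₁; inj₂; [_,_])
open import Relation.Nullary using (¬_; Dec; yes; no; contradiction)
open import Relation.Nullary.Decidable using (⌊_⌋; True; toWitness; fromWitness)
open import Relation.Binary.Definitions using (tri<; tri≈; tri>)
open import Relation.Binary.PropositionalEquality hiding ([_])
open import Function.Bundles using (_↔_; mk↔ₛ′)
open import Function.Properties.Inverse using (↔-sym; ↔-trans)
open import Algebra.Properties.CommutativeMonoid.Sum +-0-commutativeMonoid using (sum; sum-permute; sum-cong-≗)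
open import Algebra.Properties.CommutativeSemigroup +-commutativeSemigroup using (interchange)

-- The value 0 outside [0, n) is junk.
at : ∀ {n} → Vec (Fin n) n → ℕ → ℕ
at {n} σ i with i ℕ.<? n
... | yes i<n = toℕ (lookup σ (fromℕ< i<n))
... | no _    = 0

at-fromℕ< : ∀ {n} (σ : Vec (Fin n) n) {i} (i<n : i < n) → at σ i ≡ toℕ (lookup σ (fromℕ< i<n))
at-fromℕ< {n} σ {i} i<n with i ℕ.<? n
... | yes _   = cong (λ x → toℕ (lookup σ x)) (FinP.fromℕ<-cong _ _ refl _ _)
... | no i≮n  = contradiction i<n i≮n

at-toℕ : ∀ {n} (σ : Vec (Fin n) n) (i : Fin n) → at σ (toℕ i) ≡ toℕ (lookup σ i)
at-toℕ σ i = trans (at-fromℕ< σ (FinP.toℕ<n i)) (cong (λ x → toℕ (lookup σ x)) (FinP.fromℕ<-toℕ i _))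

at<n : ∀ {n} (σ : Vec (Fin n) n) {i} → i < n → at σ i < n
at<n σ i<n rewrite at-fromℕ< σ i<n = FinP.toℕ<n _

IsPerm⇒surjective : ∀ {n} (σ : Vec (Fin n) n) → IsPerm σ → ∀ y → ∃ λ i → lookup σ i ≡ y
IsPerm⇒surjective {suc n} σ σ-perm y with FinP.any? (λ i → lookup σ i F.≟ y)
... | yes hit = hit
... | no miss = contradiction (FinP.injective⇒≤ {f = avoidY} avoidY-injective) (<-irrefl refl)  -- pigeonhole
  where
  avoidY : Fin (suc n) → Fin n
  avoidY i = F.punchOut {i = y} {j = lookup σ i} (λ e → miss (i , sym e))
  avoidY-injective : ∀ {i j} → avoidY i ≡ avoidY j → i ≡ j
  avoidY-injective e = σ-perm _ _ (FinP.punchOut-injective {i = y} _ _ e)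

module _ {n} (σ : Vec (Fin n) n) (σ-perm : IsPerm σ) where

  inverse : Vec (Fin n) n
  inverse = tabulate (λ y → proj₁ (IsPerm⇒surjective σ σ-perm y))

  inverse-right : ∀ y → lookup σ (lookup inverse y) ≡ y
  inverse-right y rewrite VecP.lookup∘tabulate (λ y → proj₁ (IsPerm⇒surjective σ σ-perm y)) y =
    proj₂ (IsPerm⇒surjective σ σ-perm y)

  inverse-left : ∀ i → lookup inverse (lookup σ i) ≡ i
  inverse-left i = σ-perm _ _ (inverse-right (lookup σ i))

  inverse-IsPerm : IsPerm inverse
  inverse-IsPerm x y e = trans (sym (inverse-right x)) (trans (cong (lookup σ) e) (inverse-right y))

  toPermutation : Permutation n n
  toPermutation = permutation (lookup σ) (lookup inverse) inverse-right inverse-left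

  at-inverse-right : ∀ {j} → j < n → at σ (at inverse j) ≡ j
  at-inverse-right {j} j<n = begin
    at σ (at inverse j)                       ≡⟨ cong (at σ) (at-fromℕ< inverse j<n) ⟩
    at σ (toℕ (lookup inverse (fromℕ< j<n)))  ≡⟨ at-toℕ σ _ ⟩
    toℕ (lookup σ (lookup inverse (fromℕ< j<n))) ≡⟨ cong toℕ (inverse-right (fromℕ< j<n)) ⟩
    toℕ (fromℕ< j<n)                          ≡⟨ FinP.toℕ-fromℕ< j<n ⟩
    j                                         ∎
    where open ≡-Reasoning

  at-inverse-left : ∀ {i} → i < n → at inverse (at σ i) ≡ i
  at-inverse-left {i} i<n = begin
    at inverse (at σ i)                       ≡⟨ cong (at inverse) (at-fromℕ< σ i<n) ⟩
    at inverse (toℕ (lookup σ (fromℕ< i<n)))  ≡⟨ at-toℕ inverse _ ⟩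
    toℕ (lookup inverse (lookup σ (fromℕ< i<n))) ≡⟨ cong toℕ (inverse-left (fromℕ< i<n)) ⟩
    toℕ (fromℕ< i<n)                          ≡⟨ FinP.toℕ-fromℕ< i<n ⟩
    i                                         ∎
    where open ≡-Reasoning

sum< : ℕ → (ℕ → ℕ) → ℕ
sum< zero    f = 0
sum< (suc m) f = f 0 + sum< m (λ i → f (suc i))

sum<-cong : ∀ m {f g : ℕ → ℕ} → (∀ i → i < m → f i ≡ g i) → sum< m f ≡ sum< m g
sum<-cong zero    f≗g = refl
sum<-cong (suc m) f≗g = cong₂ _+_ (f≗g 0 (s≤s z≤n)) (sum<-cong m (λ i i<m → f≗g (suc i) (s≤s i<m)))

sum<-+ : ∀ a b (f : ℕ → ℕ) → sum< (a + b) f ≡ sum< a f + sum< b (λ i → f (a + i))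
sum<-+ zero    b f = refl
sum<-+ (suc a) b f = trans (cong (f 0 +_) (sum<-+ a b (λ i → f (suc i)))) (sym (+-assoc (f 0) _ _))

sum<-distrib-+ : ∀ m (f g : ℕ → ℕ) → sum< m (λ i → f i + g i) ≡ sum< m f + sum< m g
sum<-distrib-+ zero    f g = refl
sum<-distrib-+ (suc m) f g = begin
  (f 0 + g 0) + sum< m (λ i → f (suc i) + g (suc i))             ≡⟨ cong ((f 0 + g 0) +_) (sum<-distrib-+ m _ _) ⟩
  (f 0 + g 0) + (sum< m (λ i → f (suc i)) + sum< m (λ i → g (suc i))) ≡⟨ interchange (f 0) (g 0) _ _ ⟩
  (f 0 + sum< m (λ i → f (suc i))) + (g 0 + sum< m (λ i → g (suc i))) ∎
  where open ≡-Reasoning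

sum<-const : ∀ m k → sum< m (λ _ → k) ≡ m * k
sum<-const zero    k = refl
sum<-const (suc m) k = cong (k +_) (sum<-const m k)

sum<-≡0 : ∀ m (f : ℕ → ℕ) → (∀ i → i < m → f i ≡ 0) → sum< m f ≡ 0
sum<-≡0 m f f≡0 = trans (sum<-cong m f≡0) (trans (sum<-const m 0) (*-zeroʳ m))

sum<≡0⇒≡0 : ∀ m (f : ℕ → ℕ) → sum< m f ≡ 0 → ∀ i → i < m → f i ≡ 0
sum<≡0⇒≡0 (suc m) f e zero    _         = m+n≡0⇒m≡0 (f 0) e
sum<≡0⇒≡0 (suc m) f e (suc i) (s≤s i<m) = sum<≡0⇒≡0 m _ (m+n≡0⇒n≡0 (f 0) e) i i<m

sum<-toℕ : ∀ n (h : ℕ → ℕ) → sum {n} (λ i → h (toℕ i)) ≡ sum< n h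
sum<-toℕ zero    h = refl
sum<-toℕ (suc n) h = cong (h 0 +_) (sum<-toℕ n (λ i → h (suc i)))

sum<-permute : ∀ {n} (σ : Vec (Fin n) n) → IsPerm σ → ∀ (h : ℕ → ℕ) → sum< n (λ i → h (at σ i)) ≡ sum< n h
sum<-permute {n} σ σ-perm h = begin
  sum< n (λ i → h (at σ i))                ≡⟨ sym (sum<-toℕ n _) ⟩
  sum {n} (λ i → h (at σ (toℕ i)))         ≡⟨ sum-cong-≗ {n} (λ i → cong h (at-toℕ σ i)) ⟩
  sum {n} (λ i → h (toℕ (lookup σ i)))     ≡⟨ sym (sum-permute (λ i → h (toℕ i)) (toPermutation σ σ-perm)) ⟩
  sum {n} (λ i → h (toℕ i))                ≡⟨ sum<-toℕ n h ⟩
  sum< n h                                 ∎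
  where open ≡-Reasoning

𝟙≤ : ℕ → ℕ → ℕ
𝟙≤ a b with a ℕ.≤? b
... | yes _ = 1
... | no _  = 0

𝟙≤-yes : ∀ {a b} → a ≤ b → 𝟙≤ a b ≡ 1
𝟙≤-yes {a} {b} a≤b with a ℕ.≤? b
... | yes _   = refl
... | no a≰b  = contradiction a≤b a≰b

𝟙≤-no : ∀ {a b} → b < a → 𝟙≤ a b ≡ 0
𝟙≤-no {a} {b} b<a with a ℕ.≤? b
... | yes a≤b = contradiction a≤b (<⇒≱ b<a)
... | no _    = refl

𝟙≤≡0⇒> : ∀ {a b} → 𝟙≤ a b ≡ 0 → b < a
𝟙≤≡0⇒> {a} {b} e with a ℕ.≤? b
... | no a≰b = ≰⇒> a≰b

𝟙≤-≤1 : ∀ a b → 𝟙≤ a b ≤ 1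
𝟙≤-≤1 a b with a ℕ.≤? b
... | yes _ = s≤s z≤n
... | no _  = z≤n

𝟙≤-complement : ∀ a b → 𝟙≤ (suc a) b + 𝟙≤ b a ≡ 1
𝟙≤-complement a b with suc a ℕ.≤? b | b ℕ.≤? a
... | yes a<b | yes b≤a = contradiction b≤a (<⇒≱ a<b)
... | yes _   | no _    = refl
... | no _    | yes _   = refl
... | no a≮b  | no b≰a  = contradiction (≰⇒> b≰a) a≮b

sum<-𝟙≤ : ∀ n m → sum< n (𝟙≤ m) ≡ n ∸ m
sum<-𝟙≤ n zero = begin
  sum< n (𝟙≤ 0)    ≡⟨ sum<-cong n (λ i _ → 𝟙≤-yes {0} {i} z≤n) ⟩
  sum< n (λ _ → 1) ≡⟨ sum<-const n 1 ⟩
  n * 1            ≡⟨ *-identityʳ n ⟩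
  n                ∎
  where open ≡-Reasoning
sum<-𝟙≤ zero    (suc m) = refl
sum<-𝟙≤ (suc n) (suc m) =
  trans (cong₂ _+_ (𝟙≤-no {suc m} {0} (s≤s z≤n)) (sum<-cong n (λ i _ → 𝟙≤-suc i))) (sum<-𝟙≤ n m)
  where
  𝟙≤-suc : ∀ i → 𝟙≤ (suc m) (suc i) ≡ 𝟙≤ m i
  𝟙≤-suc i with m ℕ.≤? i
  ... | yes m≤i = 𝟙≤-yes (s≤s m≤i)
  ... | no m≰i  = 𝟙≤-no (s≤s (≰⇒> m≰i))

-- Matrices and the corner of a permutation

lookup-ext : ∀ {A : Set} {m} {u v : Vec A m} → (∀ i → lookup u i ≡ lookup v i) → u ≡ v
lookup-ext {u = u} {v} u≗v = trans (sym (VecP.tabulate∘lookup u)) (trans (VecP.tabulate-cong u≗v) (VecP.tabulate∘lookup v))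

lookup-transpose : ∀ {A : Set} {m n} (M : Vec (Vec A n) m) j i →
                   lookup (lookup (transpose M) j) i ≡ lookup (lookup M i) j
lookup-transpose (as ∷ M) j i = trans (cong (λ v → lookup v i) transpose-row) (lookup-cons i)
  where
  transpose-row : lookup (transpose (as ∷ M)) j ≡ lookup as j ∷ lookup (transpose M) j
  transpose-row = trans (VecP.lookup-⊛ j (V.replicate _ V._∷_ V.⊛ as) (transpose M))
                        (cong (λ f → f (lookup (transpose M) j))
                              (trans (VecP.lookup-⊛ j (V.replicate _ V._∷_) as)
                                     (cong (λ f → f (lookup as j)) (VecP.lookup-replicate j V._∷_))))
  lookup-cons : ∀ i → lookup (lookup as j ∷ lookup (transpose M) j) i ≡ lookup (lookup (as ∷ M) i) j
  lookup-cons F.zero    = refl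
  lookup-cons (F.suc i) = lookup-transpose M j i

transpose-tabulate : ∀ {A : Set} {m n} (h : Fin m → Fin n → A) →
  transpose (tabulate λ i → tabulate λ j → h i j) ≡ tabulate λ j → tabulate λ i → h i j
transpose-tabulate h = lookup-ext λ j → lookup-ext λ i → begin
  lookup (lookup (transpose H) j) i              ≡⟨ lookup-transpose H j i ⟩
  lookup (lookup H i) j                          ≡⟨ cong (λ v → lookup v j) (VecP.lookup∘tabulate _ i) ⟩
  lookup (tabulate (h i)) j                      ≡⟨ VecP.lookup∘tabulate (h i) j ⟩
  h i j                                          ≡⟨ sym (VecP.lookup∘tabulate (λ i → h i j) i) ⟩
  lookup (tabulate λ i → h i j) i                ≡⟨ cong (λ v → lookup v i) (sym (VecP.lookup∘tabulate _ j)) ⟩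
  lookup (lookup (tabulate λ j → tabulate λ i → h i j) j) i ∎
  where
  open ≡-Reasoning
  H = tabulate λ i → tabulate λ j → h i j

transpose-involutive : ∀ {A : Set} {m n} (M : Vec (Vec A n) m) → transpose (transpose M) ≡ M
transpose-involutive M = lookup-ext λ i → lookup-ext λ j →
  trans (lookup-transpose (transpose M) i j) (lookup-transpose M j i)

⌊⌋-⇔ : ∀ {A B : Set} (a? : Dec A) (b? : Dec B) → (A → B) → (B → A) → ⌊ a? ⌋ ≡ ⌊ b? ⌋
⌊⌋-⇔ (yes a) (yes b) A⇒B B⇒A = refl
⌊⌋-⇔ (no ¬a) (no ¬b) A⇒B B⇒A = refl
⌊⌋-⇔ (yes a) (no ¬b) A⇒B B⇒A = contradiction (A⇒B a) ¬b
⌊⌋-⇔ (no ¬a) (yes b) A⇒B B⇒A = contradiction (B⇒A b) ¬a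

⌊⌋≡true : ∀ {A : Set} (a? : Dec A) → A → ⌊ a? ⌋ ≡ true
⌊⌋≡true (yes _) a = refl
⌊⌋≡true (no ¬a) a = contradiction a ¬a

⌊⌋≡false : ∀ {A : Set} (a? : Dec A) → ¬ A → ⌊ a? ⌋ ≡ false
⌊⌋≡false (yes a) ¬a = contradiction a ¬a
⌊⌋≡false (no _)  ¬a = refl

⌊⌋≡true⇒ : ∀ {A : Set} (a? : Dec A) → ⌊ a? ⌋ ≡ true → A
⌊⌋≡true⇒ (yes a) _ = a

⌊≟⌋-sym : ∀ {n} (x y : Fin n) → ⌊ x F.≟ y ⌋ ≡ ⌊ y F.≟ x ⌋
⌊≟⌋-sym x y = ⌊⌋-⇔ (x F.≟ y) (y F.≟ x) sym sym

⌊≟⌋-toℕ : ∀ {n} (x y : Fin n) → ⌊ x F.≟ y ⌋ ≡ ⌊ toℕ x ℕ.≟ toℕ y ⌋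
⌊≟⌋-toℕ x y = ⌊⌋-⇔ (x F.≟ y) (toℕ x ℕ.≟ toℕ y) (cong toℕ) FinP.toℕ-injective

ones-indicator≡0 : ∀ {m N} (g : Fin m → Fin N) y → (∀ j → g j ≢ y) →
                   ones (tabulate λ j → ⌊ g j F.≟ y ⌋) ≡ 0
ones-indicator≡0 {zero}  g y miss = refl
ones-indicator≡0 {suc m} g y miss with g F.zero F.≟ y
... | yes hit = contradiction hit (miss F.zero)
... | no _    = ones-indicator≡0 (λ j → g (F.suc j)) y (λ j → miss (F.suc j))

ones-indicator≡1 : ∀ {m N} (g : Fin m → Fin N) → (∀ {a b} → g a ≡ g b → a ≡ b) → ∀ y j₀ → g j₀ ≡ y →
                   ones (tabulate λ j → ⌊ g j F.≟ y ⌋) ≡ 1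
ones-indicator≡1 {suc m} g g-inj y F.zero hit with g F.zero F.≟ y
... | yes _  = cong suc (ones-indicator≡0 (λ j → g (F.suc j)) y (λ j e → FinP.0≢1+n (g-inj (trans hit (sym e)))))
... | no g₀≢y = contradiction hit g₀≢y
ones-indicator≡1 {suc m} g g-inj y (F.suc j₀) hit with g F.zero F.≟ y
... | yes e = contradiction (g-inj (trans e (sym hit))) FinP.0≢1+n
... | no _  = ones-indicator≡1 (λ j → g (F.suc j)) (λ e → FinP.suc-injective (g-inj e)) y j₀ hit

isEmpty : ℕ → ℕ
isEmpty zero    = 1
isEmpty (suc _) = 0

totalOnes-tabulate : ∀ {m k} (f : Fin m → Vec Bool k) → totalOnes (tabulate f) ≡ sum (λ i → ones (f i))
totalOnes-tabulate {zero}  f = refl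
totalOnes-tabulate {suc m} f = cong (ones (f F.zero) +_) (totalOnes-tabulate (λ i → f (F.suc i)))

emptyLines-tabulate : ∀ {m k} (f : Fin m → Vec Bool k) → emptyLines (tabulate f) ≡ sum (λ i → isEmpty (ones (f i)))
emptyLines-tabulate {zero}  f = refl
emptyLines-tabulate {suc m} f with ones (f F.zero)
... | zero  = cong suc (emptyLines-tabulate (λ i → f (F.suc i)))
... | suc _ = emptyLines-tabulate (λ i → f (F.suc i))

isEmpty-𝟙≤ : ∀ a b → isEmpty (𝟙≤ (suc a) b) ≡ 𝟙≤ b a
isEmpty-𝟙≤ a b with suc a ℕ.≤? b | b ℕ.≤? a
... | yes a<b | yes b≤a = contradiction b≤a (<⇒≱ a<b)
... | yes _   | no _    = refl
... | no _    | yes _   = refl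
... | no a≮b  | no b≰a  = contradiction (≰⇒> b≰a) a≮b

entry-permMatrix : ∀ {N} (σ : Vec (Fin N) N) x y → entry (permMatrix σ) x y ≡ ⌊ lookup σ x F.≟ y ⌋
entry-permMatrix σ x y = trans (cong (λ v → lookup v y) (VecP.lookup∘tabulate _ x)) (VecP.lookup∘tabulate _ y)

d+c+r≡d+r+c : ∀ d c r → d + c + r ≡ d + r + c
d+c+r≡d+r+c d c r = trans (+-assoc d c r) (trans (cong (d +_) (+-comm c r)) (sym (+-assoc d r c)))

module Corner (d c r : ℕ) where

  rowEmbed : Fin (d + r) → Fin (d + c + r)
  rowEmbed i = inject≤ i (rows≤ d c r)

  colEmbed : Fin (d + c) → Fin (d + c + r)
  colEmbed j = inject≤ j (cols≤ d c r)

  corner : Vec (Fin (d + c + r)) (d + c + r) → Matrix (d + r) (d + c)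
  corner σ = upperLeft d c r (permMatrix σ)

  LowerRowsInCornerColumns : (ℕ → ℕ) → Set
  LowerRowsInCornerColumns s = ∀ i → d + r ≤ i → i < d + c + r → s i < d + c

  module _ (σ : Vec (Fin (d + c + r)) (d + c + r)) (σ-perm : IsPerm σ) where

    private
      σ⁻¹ = inverse σ σ-perm
      dot : Fin (d + r) → Fin (d + c) → Bool
      dot i j = ⌊ lookup σ (rowEmbed i) F.≟ colEmbed j ⌋

    corner-tabulate : corner σ ≡ tabulate λ i → tabulate λ j → dot i j
    corner-tabulate = VecP.tabulate-cong (λ i → VecP.tabulate-cong (λ j → entry-permMatrix σ _ _))

    toℕ-σ-rowEmbed : ∀ i → toℕ (lookup σ (rowEmbed i)) ≡ at σ (toℕ i)
    toℕ-σ-rowEmbed i = trans (sym (at-toℕ σ (rowEmbed i))) (cong (at σ) (FinP.toℕ-inject≤ i _))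

    toℕ-σ⁻¹-colEmbed : ∀ j → toℕ (lookup σ⁻¹ (colEmbed j)) ≡ at σ⁻¹ (toℕ j)
    toℕ-σ⁻¹-colEmbed j = trans (sym (at-toℕ σ⁻¹ (colEmbed j))) (cong (at σ⁻¹) (FinP.toℕ-inject≤ j _))

    ones-cornerRow : ∀ i → ones (tabulate (dot i)) ≡ 𝟙≤ (suc (at σ (toℕ i))) (d + c)
    ones-cornerRow i with at σ (toℕ i) ℕ.<? d + c
    ... | yes σi<d+c = trans (cong ones (VecP.tabulate-cong (λ j → ⌊≟⌋-sym (lookup σ (rowEmbed i)) (colEmbed j))))
                             (ones-indicator≡1 colEmbed (λ {a} {b} → FinP.inject≤-injective _ _ a b) _ j₀ hit)
      where
      j₀ = fromℕ< σi<d+c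
      hit : colEmbed j₀ ≡ lookup σ (rowEmbed i)
      hit = FinP.toℕ-injective (trans (FinP.toℕ-inject≤ j₀ _)
              (trans (FinP.toℕ-fromℕ< σi<d+c) (sym (toℕ-σ-rowEmbed i))))
    ... | no σi≮d+c = trans (cong ones (VecP.tabulate-cong (λ j → ⌊≟⌋-sym (lookup σ (rowEmbed i)) (colEmbed j))))
                            (ones-indicator≡0 colEmbed _ miss)
      where
      miss : ∀ j → colEmbed j ≢ lookup σ (rowEmbed i)
      miss j e = σi≮d+c (subst (_< d + c)
        (trans (sym (FinP.toℕ-inject≤ j _)) (trans (cong toℕ e) (toℕ-σ-rowEmbed i))) (FinP.toℕ<n j))

    ones-cornerCol : ∀ j → ones (tabulate λ i → dot i j) ≡ 𝟙≤ (suc (at σ⁻¹ (toℕ j))) (d + r)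
    ones-cornerCol j with at σ⁻¹ (toℕ j) ℕ.<? d + r
    ... | yes σ⁻¹j<d+r = ones-indicator≡1 (λ i → lookup σ (rowEmbed i))
                           (λ {a} {b} e → FinP.inject≤-injective _ _ a b (σ-perm _ _ e)) (colEmbed j) i₀ hit
      where
      i₀ = fromℕ< σ⁻¹j<d+r
      hit : lookup σ (rowEmbed i₀) ≡ colEmbed j
      hit = trans (cong (lookup σ) (FinP.toℕ-injective (trans (FinP.toℕ-inject≤ i₀ _)
              (trans (FinP.toℕ-fromℕ< σ⁻¹j<d+r) (sym (toℕ-σ⁻¹-colEmbed j))))))
              (inverse-right σ σ-perm (colEmbed j))
    ... | no σ⁻¹j≮d+r = ones-indicator≡0 (λ i → lookup σ (rowEmbed i)) (colEmbed j) miss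
      where
      miss : ∀ i → lookup σ (rowEmbed i) ≢ colEmbed j
      miss i e = σ⁻¹j≮d+r (subst (_< d + r)
        (trans (sym (FinP.toℕ-inject≤ i _))
          (trans (cong toℕ (trans (sym (inverse-left σ σ-perm (rowEmbed i))) (cong (lookup σ⁻¹) e)))
                 (toℕ-σ⁻¹-colEmbed j)))
        (FinP.toℕ<n i))

    transpose-corner : transpose (corner σ) ≡ tabulate λ j → tabulate λ i → dot i j
    transpose-corner = trans (cong transpose corner-tabulate) (transpose-tabulate dot)

    corner-IsPartialPerm : IsPartialPerm (corner σ)
    corner-IsPartialPerm rewrite corner-tabulate =
      AllVP.tabulate⁺ (λ i → subst (_≤ 1) (sym (ones-cornerRow i)) (𝟙≤-≤1 _ _)) ,
      subst (AllV (λ col → ones col ≤ 1)) (sym (transpose-tabulate dot))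
            (AllVP.tabulate⁺ (λ j → subst (_≤ 1) (sym (ones-cornerCol j)) (𝟙≤-≤1 _ _)))

    emptyLines-corner : emptyLines (corner σ) ≡ sum< (d + r) (λ i → 𝟙≤ (d + c) (at σ i))
    emptyLines-corner = begin
      emptyLines (corner σ)                                  ≡⟨ cong emptyLines corner-tabulate ⟩
      emptyLines (tabulate λ i → tabulate (dot i))           ≡⟨ emptyLines-tabulate (λ i → tabulate (dot i)) ⟩
      sum {d + r} (λ i → isEmpty (ones (tabulate (dot i))))          ≡⟨ sum-cong-≗ {d + r} (λ i →
                                                                  trans (cong isEmpty (ones-cornerRow i)) (isEmpty-𝟙≤ _ _)) ⟩
      sum {d + r} (λ i → 𝟙≤ (d + c) (at σ (toℕ i)))                  ≡⟨ sum<-toℕ (d + r) _ ⟩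
      sum< (d + r) (λ i → 𝟙≤ (d + c) (at σ i))               ∎
      where open ≡-Reasoning

    totalOnes-corner : totalOnes (corner σ) ≡ sum< (d + r) (λ i → 𝟙≤ (suc (at σ i)) (d + c))
    totalOnes-corner = begin
      totalOnes (corner σ)                                   ≡⟨ cong totalOnes corner-tabulate ⟩
      totalOnes (tabulate λ i → tabulate (dot i))            ≡⟨ totalOnes-tabulate (λ i → tabulate (dot i)) ⟩
      sum {d + r} (λ i → ones (tabulate (dot i)))                    ≡⟨ sum-cong-≗ {d + r} ones-cornerRow ⟩
      sum {d + r} (λ i → 𝟙≤ (suc (at σ (toℕ i))) (d + c))            ≡⟨ sum<-toℕ (d + r) _ ⟩
      sum< (d + r) (λ i → 𝟙≤ (suc (at σ i)) (d + c))         ∎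
      where open ≡-Reasoning

    emptyLines-transpose-corner : emptyLines (transpose (corner σ)) ≡ sum< (d + c) (λ j → 𝟙≤ (d + r) (at σ⁻¹ j))
    emptyLines-transpose-corner = begin
      emptyLines (transpose (corner σ))                      ≡⟨ cong emptyLines transpose-corner ⟩
      emptyLines (tabulate λ j → tabulate λ i → dot i j)     ≡⟨ emptyLines-tabulate (λ j → tabulate λ i → dot i j) ⟩
      sum {d + c} (λ j → isEmpty (ones (tabulate λ i → dot i j)))    ≡⟨ sum-cong-≗ {d + c} (λ j →
                                                                  trans (cong isEmpty (ones-cornerCol j)) (isEmpty-𝟙≤ _ _)) ⟩
      sum {d + c} (λ j → 𝟙≤ (d + r) (at σ⁻¹ (toℕ j)))                ≡⟨ sum<-toℕ (d + c) _ ⟩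
      sum< (d + c) (λ j → 𝟙≤ (d + r) (at σ⁻¹ j))             ∎
      where open ≡-Reasoning

  module _ (σ : Vec (Fin (d + c + r)) (d + c + r)) (σ-perm : IsPerm σ) where

    private
      highAt : ℕ → ℕ
      highAt i = 𝟙≤ (d + c) (at σ i)

    -- σ is a bijection, so exactly r rows i have σ i ≥ d + c.
    sum<-highAt : sum< (d + c + r) highAt ≡ r
    sum<-highAt = begin
      sum< (d + c + r) highAt           ≡⟨ sum<-permute σ σ-perm (𝟙≤ (d + c)) ⟩
      sum< (d + c + r) (𝟙≤ (d + c))     ≡⟨ sum<-𝟙≤ (d + c + r) (d + c) ⟩
      d + c + r ∸ (d + c)               ≡⟨ m+n∸m≡n (d + c) r ⟩
      r                                 ∎
      where open ≡-Reasoning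

    sum<-split : ∀ (f : ℕ → ℕ) → sum< (d + c + r) f ≡ sum< (d + r) f + sum< c (λ k → f (d + r + k))
    sum<-split f = trans (cong (λ m → sum< m f) (d+c+r≡d+r+c d c r)) (sum<-+ (d + r) c f)

    module _ (lower : LowerRowsInCornerColumns (at σ)) where

      private
        cornerRows≡r : sum< (d + r) highAt ≡ r
        cornerRows≡r = begin
          sum< (d + r) highAt                                        ≡⟨ sym (+-identityʳ _) ⟩
          sum< (d + r) highAt + 0                                    ≡⟨ cong (sum< (d + r) highAt +_) (sym lowerRows≡0) ⟩
          sum< (d + r) highAt + sum< c (λ k → highAt (d + r + k))    ≡⟨ sym (sum<-split highAt) ⟩
          sum< (d + c + r) highAt                                    ≡⟨ sum<-highAt ⟩
          r                                                          ∎
          where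
          open ≡-Reasoning
          lowerRows≡0 : sum< c (λ k → highAt (d + r + k)) ≡ 0
          lowerRows≡0 = sum<-≡0 c _ (λ k k<c → 𝟙≤-no (lower (d + r + k) (m≤m+n (d + r) k)
                          (subst (d + r + k <_) (sym (d+c+r≡d+r+c d c r)) (+-monoʳ-< (d + r) k<c))))

      emptyLines-corner≡r : emptyLines (corner σ) ≡ r
      emptyLines-corner≡r = trans (emptyLines-corner σ σ-perm) cornerRows≡r

      totalOnes-corner≡d : totalOnes (corner σ) ≡ d
      totalOnes-corner≡d = +-cancelʳ-≡ r _ _ (begin
        totalOnes (corner σ) + r                                         ≡⟨ cong₂ _+_ (totalOnes-corner σ σ-perm) (sym cornerRows≡r) ⟩
        sum< (d + r) (λ i → 𝟙≤ (suc (at σ i)) (d + c)) + sum< (d + r) highAt ≡⟨ sym (sum<-distrib-+ (d + r) _ _) ⟩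
        sum< (d + r) (λ i → 𝟙≤ (suc (at σ i)) (d + c) + highAt i)       ≡⟨ sum<-cong (d + r) (λ i _ → 𝟙≤-complement (at σ i) (d + c)) ⟩
        sum< (d + r) (λ _ → 1)                                          ≡⟨ sum<-const (d + r) 1 ⟩
        (d + r) * 1                                                     ≡⟨ *-identityʳ (d + r) ⟩
        d + r                                                           ∎)
        where open ≡-Reasoning

      emptyColumns-corner≡c : emptyLines (transpose (corner σ)) ≡ c
      emptyColumns-corner≡c = begin
        emptyLines (transpose (corner σ))                             ≡⟨ emptyLines-transpose-corner σ σ-perm ⟩
        sum< (d + c) lowAt⁻¹                                          ≡⟨ sym (+-identityʳ _) ⟩
        sum< (d + c) lowAt⁻¹ + 0                                      ≡⟨ cong (sum< (d + c) lowAt⁻¹ +_) (sym rightColumns≡0) ⟩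
        sum< (d + c) lowAt⁻¹ + sum< r (λ k → lowAt⁻¹ (d + c + k))     ≡⟨ sym (sum<-+ (d + c) r lowAt⁻¹) ⟩
        sum< (d + c + r) lowAt⁻¹                                      ≡⟨ sum<-permute σ⁻¹ (inverse-IsPerm σ σ-perm) (𝟙≤ (d + r)) ⟩
        sum< (d + c + r) (𝟙≤ (d + r))                                 ≡⟨ sum<-𝟙≤ (d + c + r) (d + r) ⟩
        d + c + r ∸ (d + r)                                           ≡⟨ cong (_∸ (d + r)) (d+c+r≡d+r+c d c r) ⟩
        d + r + c ∸ (d + r)                                           ≡⟨ m+n∸m≡n (d + r) c ⟩
        c                                                             ∎
        where
        open ≡-Reasoning
        σ⁻¹ = inverse σ σ-perm
        lowAt⁻¹ : ℕ → ℕ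
        lowAt⁻¹ j = 𝟙≤ (d + r) (at σ⁻¹ j)
        rightColumns≡0 : sum< r (λ k → lowAt⁻¹ (d + c + k)) ≡ 0
        rightColumns≡0 = sum<-≡0 r _ λ k k<r → 𝟙≤-no (≰⇒> λ d+r≤σ⁻¹j →
          let j<n = +-monoʳ-< (d + c) k<r
          in <⇒≱ (lower _ d+r≤σ⁻¹j (at<n σ⁻¹ j<n))
                 (subst (d + c ≤_) (sym (at-inverse-right σ σ-perm j<n)) (m≤m+n (d + c) k)))

    LowerRowsInCornerColumns⇒IsInS : LowerRowsInCornerColumns (at σ) → IsInS d c r (corner σ)
    LowerRowsInCornerColumns⇒IsInS lower =
      corner-IsPartialPerm σ σ-perm , totalOnes-corner≡d lower , emptyLines-corner≡r lower , emptyColumns-corner≡c lower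

    IsInS⇒LowerRowsInCornerColumns : IsInS d c r (corner σ) → LowerRowsInCornerColumns (at σ)
    IsInS⇒LowerRowsInCornerColumns (_ , _ , emptyLines≡r , _) i d+r≤i i<n =
      subst (λ x → at σ x < d + c) d+r+k≡i (𝟙≤≡0⇒> (lowerRows≡0 k k<c))
      where
      k = i ∸ (d + r)
      d+r+k≡i : d + r + k ≡ i
      d+r+k≡i = m+[n∸m]≡n d+r≤i
      k<c : k < c
      k<c = +-cancelˡ-< (d + r) k c (subst (_< d + r + c) (sym d+r+k≡i) (subst (i <_) (d+c+r≡d+r+c d c r) i<n))
      lowerRows≡0 : ∀ k → k < c → highAt (d + r + k) ≡ 0
      lowerRows≡0 = sum<≡0⇒≡0 c _ (+-cancelˡ-≡ r _ _ (begin
        r + sum< c (λ k → highAt (d + r + k))                      ≡⟨ cong (_+ sum< c (λ k → highAt (d + r + k)))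
                                                                        (trans (sym emptyLines≡r) (emptyLines-corner σ σ-perm)) ⟩
        sum< (d + r) highAt + sum< c (λ k → highAt (d + r + k))    ≡⟨ sym (sum<-split highAt) ⟩
        sum< (d + c + r) highAt                                    ≡⟨ sum<-highAt ⟩
        r                                                          ≡⟨ sym (+-identityʳ r) ⟩
        r + 0                                                      ∎))
        where open ≡-Reasoning

-- Occurrences of patterns of length 3

indices : ∀ {n} → Subset n → List (Fin n)
indices S = select S (V.allFin _)

select-map : ∀ {A B : Set} {n} (f : A → B) (S : Subset n) (v : Vec A n) →
             select S (V.map f v) ≡ L.map f (select S v)
select-map f []            []      = refl
select-map f (inside ∷ S)  (x ∷ v) = cong (f x ∷_) (select-map f S v)
select-map f (outside ∷ S) (x ∷ v) = select-map f S v

select≡map-lookup-indices : ∀ {A : Set} {n} (S : Subset n) (v : Vec A n) →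
                            select S v ≡ L.map (lookup v) (indices S)
select≡map-lookup-indices {n = n} S v = begin
  select S v                               ≡⟨ cong (select S) (sym (VecP.tabulate∘lookup v)) ⟩
  select S (tabulate (lookup v))           ≡⟨ cong (select S) (VecP.tabulate-∘ (lookup v) (λ i → i)) ⟩
  select S (V.map (lookup v) (V.allFin n)) ≡⟨ select-map (lookup v) S (V.allFin n) ⟩
  L.map (lookup v) (indices S)             ∎
  where open ≡-Reasoning

indices-outside : ∀ {n} (S : Subset n) → indices (outside ∷ S) ≡ L.map F.suc (indices S)
indices-outside {n} S = trans (cong (select S) (VecP.tabulate-∘ F.suc (λ i → i))) (select-map F.suc S (V.allFin n))

indices-inside : ∀ {n} (S : Subset n) → indices (inside ∷ S) ≡ F.zero ∷ L.map F.suc (indices S)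
indices-inside S = cong (F.zero ∷_) (indices-outside S)

Increasing : ∀ {n} → List (Fin n) → Set
Increasing = Linked F._<_

map-suc-Increasing : ∀ {n} {xs : List (Fin n)} → Increasing xs → Increasing (L.map F.suc xs)
map-suc-Increasing []            = []
map-suc-Increasing [-]           = [-]
map-suc-Increasing (x<y ∷ y<ys)  = s≤s x<y ∷ map-suc-Increasing y<ys

zero∷map-suc-Increasing : ∀ {n} {xs : List (Fin n)} → Increasing xs → Increasing (F.zero ∷ L.map F.suc xs)
zero∷map-suc-Increasing {xs = []}    _   = [-]
zero∷map-suc-Increasing {xs = _ ∷ _} inc = s≤s z≤n ∷ map-suc-Increasing inc

indices-Increasing : ∀ {n} (S : Subset n) → Increasing (indices S)
indices-Increasing []            = []
indices-Increasing (inside ∷ S)  rewrite indices-inside S  = zero∷map-suc-Increasing (indices-Increasing S)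
indices-Increasing (outside ∷ S) rewrite indices-outside S = map-suc-Increasing (indices-Increasing S)

lowerIndices : ∀ {n} → List (Fin (suc n)) → List (Fin n)
lowerIndices []             = []
lowerIndices (F.zero ∷ xs)  = lowerIndices xs
lowerIndices (F.suc x ∷ xs) = x ∷ lowerIndices xs

map-suc-lowerIndices : ∀ {n} {x : Fin (suc n)} xs → Increasing (x ∷ xs) → L.map F.suc (lowerIndices xs) ≡ xs
map-suc-lowerIndices []              _          = refl
map-suc-lowerIndices (F.suc y ∷ ys)  (_ ∷ inc)  = cong (F.suc y ∷_) (map-suc-lowerIndices ys inc)

lowerIndices-Increasing-suc : ∀ {n} {x : Fin n} xs → Increasing (F.suc x ∷ xs) → Increasing (x ∷ lowerIndices xs)
lowerIndices-Increasing-suc []             _                = [-]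
lowerIndices-Increasing-suc (F.suc y ∷ ys) (s≤s x<y ∷ inc)  = x<y ∷ lowerIndices-Increasing-suc ys inc

lowerIndices-Increasing-zero : ∀ {n} (xs : List (Fin (suc n))) → Increasing (F.zero ∷ xs) → Increasing (lowerIndices xs)
lowerIndices-Increasing-zero []             _         = []
lowerIndices-Increasing-zero (F.suc y ∷ ys) (_ ∷ inc) = lowerIndices-Increasing-suc ys inc

fromIndices : ∀ {n} → List (Fin n) → Subset n
fromIndices {zero}  _              = []
fromIndices {suc n} []             = outside ∷ fromIndices {n} []
fromIndices {suc n} (F.zero ∷ xs)  = inside ∷ fromIndices (lowerIndices xs)
fromIndices {suc n} (F.suc x ∷ xs) = outside ∷ fromIndices (x ∷ lowerIndices xs)

indices-fromIndices : ∀ {n} (xs : List (Fin n)) → Increasing xs → indices (fromIndices xs) ≡ xs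
indices-fromIndices {zero}  []             _   = refl
indices-fromIndices {suc n} []             _   =
  trans (indices-outside (fromIndices {n} [])) (cong (L.map F.suc) (indices-fromIndices {n} [] []))
indices-fromIndices {suc n} (F.zero ∷ xs)  inc = begin
  indices (inside ∷ fromIndices (lowerIndices xs))                ≡⟨ indices-inside (fromIndices (lowerIndices xs)) ⟩
  F.zero ∷ L.map F.suc (indices (fromIndices (lowerIndices xs)))  ≡⟨ cong (λ ys → F.zero ∷ L.map F.suc ys)
                                                                      (indices-fromIndices _ (lowerIndices-Increasing-zero xs inc)) ⟩
  F.zero ∷ L.map F.suc (lowerIndices xs)                          ≡⟨ cong (F.zero ∷_) (map-suc-lowerIndices xs inc) ⟩
  F.zero ∷ xs                                                     ∎
  where open ≡-Reasoning
indices-fromIndices {suc n} (F.suc x ∷ xs) inc = begin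
  indices (outside ∷ fromIndices (x ∷ lowerIndices xs))           ≡⟨ indices-outside (fromIndices (x ∷ lowerIndices xs)) ⟩
  L.map F.suc (indices (fromIndices (x ∷ lowerIndices xs)))       ≡⟨ cong (L.map F.suc)
                                                                      (indices-fromIndices _ (lowerIndices-Increasing-suc xs inc)) ⟩
  F.suc x ∷ L.map F.suc (lowerIndices xs)                         ≡⟨ cong (F.suc x ∷_) (map-suc-lowerIndices xs inc) ⟩
  F.suc x ∷ xs                                                    ∎
  where open ≡-Reasoning

dotMatrix : ∀ {N} → Vec (Fin N) N → List (Fin N) → List (Fin N) → List (List Bool)
dotMatrix σ rows cols = L.map (λ i → L.map (λ j → ⌊ lookup σ i F.≟ j ⌋) cols) rows

submatrix-permMatrix : ∀ {N} (R C : Subset N) (σ : Vec (Fin N) N) →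
                       submatrix R C (permMatrix σ) ≡ dotMatrix σ (indices R) (indices C)
submatrix-permMatrix R C σ = begin
  L.map (select C) (select R (permMatrix σ))                      ≡⟨ cong (L.map (select C)) (select≡map-lookup-indices R _) ⟩
  L.map (select C) (L.map (lookup (permMatrix σ)) (indices R))    ≡⟨ sym (ListP.map-∘ (indices R)) ⟩
  L.map (λ i → select C (lookup (permMatrix σ) i)) (indices R)    ≡⟨ ListP.map-cong row (indices R) ⟩
  dotMatrix σ (indices R) (indices C)                             ∎
  where
  open ≡-Reasoning
  row : ∀ i → select C (lookup (permMatrix σ) i) ≡ L.map (λ j → ⌊ lookup σ i F.≟ j ⌋) (indices C)
  row i = trans (cong (select C) (VecP.lookup∘tabulate _ i))
                (trans (select≡map-lookup-indices C _) (ListP.map-cong (VecP.lookup∘tabulate _) (indices C)))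

Increasing3 : ∀ {N} → Vec (Fin N) 3 → Set
Increasing3 (a ∷ b ∷ c ∷ []) = a F.< b × b F.< c

Increasing3⇒Increasing : ∀ {N} (v : Vec (Fin N) 3) → Increasing3 v → Increasing (V.toList v)
Increasing3⇒Increasing (a ∷ b ∷ c ∷ []) (a<b , b<c) = a<b ∷ b<c ∷ [-]

Increasing3-injective : ∀ {N} (v : Vec (Fin N) 3) → Increasing3 v → ∀ s t → lookup v s ≡ lookup v t → s ≡ t
Increasing3-injective (a ∷ b ∷ c ∷ []) (a<b , b<c) = injective
  where
  a<c = <-trans a<b b<c
  ≢< : ∀ {x y : Fin _} → x F.< y → x ≢ y
  ≢< x<y x≡y = <-irrefl (cong toℕ x≡y) x<y
  injective : ∀ s t → lookup (a ∷ b ∷ c ∷ []) s ≡ lookup (a ∷ b ∷ c ∷ []) t → s ≡ t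
  injective F.zero                 F.zero                 _ = refl
  injective (F.suc F.zero)         (F.suc F.zero)         _ = refl
  injective (F.suc (F.suc F.zero)) (F.suc (F.suc F.zero)) _ = refl
  injective F.zero                 (F.suc F.zero)         e = contradiction e (≢< a<b)
  injective F.zero                 (F.suc (F.suc F.zero)) e = contradiction e (≢< a<c)
  injective (F.suc F.zero)         (F.suc (F.suc F.zero)) e = contradiction e (≢< b<c)
  injective (F.suc F.zero)         F.zero                 e = contradiction (sym e) (≢< a<b)
  injective (F.suc (F.suc F.zero)) F.zero                 e = contradiction (sym e) (≢< a<c)
  injective (F.suc (F.suc F.zero)) (F.suc F.zero)         e = contradiction (sym e) (≢< b<c)

record Embedding {N} (σ : Vec (Fin N) N) (π : Vec (Fin 3) 3) : Set where
  constructor embedding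
  field
    rows cols       : Vec (Fin N) 3
    rows-increasing : Increasing3 rows
    cols-increasing : Increasing3 cols
    hits            : ∀ t → lookup σ (lookup rows t) ≡ lookup cols (lookup π t)

listMatrix3 : (Fin 3 → Fin 3 → Bool) → List (List Bool)
listMatrix3 f = V.toList (tabulate λ s → V.toList (tabulate (f s)))

listMatrix3-cong : ∀ {f g} → (∀ s t → f s t ≡ g s t) → listMatrix3 f ≡ listMatrix3 g
listMatrix3-cong f≗g = cong V.toList (VecP.tabulate-cong (λ s → cong V.toList (VecP.tabulate-cong (f≗g s))))

listEntry : List (List Bool) → ℕ → ℕ → Bool
listEntry []            _       _ = false
listEntry ([] ∷ _)      zero    _ = false
listEntry ((b ∷ _) ∷ _) zero    zero = b
listEntry ((_ ∷ bs) ∷ M) zero   (suc j) = listEntry (bs ∷ M) zero j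
listEntry (_ ∷ M)       (suc i) j = listEntry M i j

listEntry-listMatrix3 : ∀ f s t → listEntry (listMatrix3 f) (toℕ s) (toℕ t) ≡ f s t
listEntry-listMatrix3 f F.zero                 F.zero                 = refl
listEntry-listMatrix3 f F.zero                 (F.suc F.zero)         = refl
listEntry-listMatrix3 f F.zero                 (F.suc (F.suc F.zero)) = refl
listEntry-listMatrix3 f (F.suc F.zero)         F.zero                 = refl
listEntry-listMatrix3 f (F.suc F.zero)         (F.suc F.zero)         = refl
listEntry-listMatrix3 f (F.suc F.zero)         (F.suc (F.suc F.zero)) = refl
listEntry-listMatrix3 f (F.suc (F.suc F.zero)) F.zero                 = refl
listEntry-listMatrix3 f (F.suc (F.suc F.zero)) (F.suc F.zero)         = refl
listEntry-listMatrix3 f (F.suc (F.suc F.zero)) (F.suc (F.suc F.zero)) = refl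

matrixList-permMatrix : (π : Vec (Fin 3) 3) → matrixList (permMatrix π) ≡ listMatrix3 (λ s t → ⌊ lookup π s F.≟ t ⌋)
matrixList-permMatrix π = refl

dotMatrix-toList : ∀ {N} (σ : Vec (Fin N) N) (rows cols : Vec (Fin N) 3) →
  dotMatrix σ (V.toList rows) (V.toList cols) ≡ listMatrix3 (λ s t → ⌊ lookup σ (lookup rows s) F.≟ lookup cols t ⌋)
dotMatrix-toList σ (_ ∷ _ ∷ _ ∷ []) (_ ∷ _ ∷ _ ∷ []) = refl

Contains⇒Embedding : ∀ {N} (σ : Vec (Fin N) N) (π : Vec (Fin 3) 3) → Contains σ π → Embedding σ π
Contains⇒Embedding σ π (R , C , eq) =
  fromDots (indices R) (indices C) (indices-Increasing R) (indices-Increasing C)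
           (trans (sym (submatrix-permMatrix R C σ)) eq)
  where
  fromDots : ∀ is cs → Increasing is → Increasing cs → dotMatrix σ is cs ≡ matrixList (permMatrix π) → Embedding σ π
  fromDots (i₀ ∷ i₁ ∷ i₂ ∷ []) (c₀ ∷ c₁ ∷ c₂ ∷ []) (i₀<i₁ ∷ i₁<i₂ ∷ [-]) (c₀<c₁ ∷ c₁<c₂ ∷ [-]) dots≡π =
    embedding rows cols (i₀<i₁ , i₁<i₂) (c₀<c₁ , c₁<c₂) λ t →
      ⌊⌋≡true⇒ (lookup σ (lookup rows t) F.≟ lookup cols (lookup π t)) (begin
        ⌊ lookup σ (lookup rows t) F.≟ lookup cols (lookup π t) ⌋ ≡⟨ sym (listEntry-listMatrix3
                                                                      (λ s u → ⌊ lookup σ (lookup rows s) F.≟ lookup cols u ⌋) t (lookup π t)) ⟩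
        listEntry (dotMatrix σ (V.toList rows) (V.toList cols)) (toℕ t) (toℕ (lookup π t))
                                                                 ≡⟨ cong (λ M → listEntry M (toℕ t) (toℕ (lookup π t))) dots≡π ⟩
        listEntry (matrixList (permMatrix π)) (toℕ t) (toℕ (lookup π t))
                                                                 ≡⟨ listEntry-listMatrix3 (λ s u → ⌊ lookup π s F.≟ u ⌋) t (lookup π t) ⟩
        ⌊ lookup π t F.≟ lookup π t ⌋                           ≡⟨ ⌊⌋≡true (lookup π t F.≟ lookup π t) refl ⟩
        true                                                     ∎)
    where
    open ≡-Reasoning
    rows = i₀ ∷ i₁ ∷ i₂ ∷ []
    cols = c₀ ∷ c₁ ∷ c₂ ∷ []
  fromDots [] _ _ _ ()
  fromDots (_ ∷ []) _ _ _ ()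
  fromDots (_ ∷ _ ∷ []) _ _ _ ()
  fromDots (_ ∷ _ ∷ _ ∷ _ ∷ _) _ _ _ ()
  fromDots (_ ∷ _ ∷ _ ∷ []) [] _ _ ()
  fromDots (_ ∷ _ ∷ _ ∷ []) (_ ∷ []) _ _ ()
  fromDots (_ ∷ _ ∷ _ ∷ []) (_ ∷ _ ∷ []) _ _ ()
  fromDots (_ ∷ _ ∷ _ ∷ []) (_ ∷ _ ∷ _ ∷ _ ∷ _) _ _ ()

Embedding⇒Contains : ∀ {N} {σ : Vec (Fin N) N} {π : Vec (Fin 3) 3} → Embedding σ π → Contains σ π
Embedding⇒Contains {σ = σ} {π} (embedding rows cols rows-inc cols-inc hits) =
  fromIndices (V.toList rows) , fromIndices (V.toList cols) , (begin
    submatrix (fromIndices (V.toList rows)) (fromIndices (V.toList cols)) (permMatrix σ)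
      ≡⟨ submatrix-permMatrix (fromIndices (V.toList rows)) (fromIndices (V.toList cols)) σ ⟩
    dotMatrix σ (indices (fromIndices (V.toList rows))) (indices (fromIndices (V.toList cols)))
      ≡⟨ cong₂ (dotMatrix σ) (indices-fromIndices _ (Increasing3⇒Increasing rows rows-inc))
                              (indices-fromIndices _ (Increasing3⇒Increasing cols cols-inc)) ⟩
    dotMatrix σ (V.toList rows) (V.toList cols)
      ≡⟨ dotMatrix-toList σ rows cols ⟩
    listMatrix3 (λ s t → ⌊ lookup σ (lookup rows s) F.≟ lookup cols t ⌋)
      ≡⟨ listMatrix3-cong dots ⟩
    listMatrix3 (λ s t → ⌊ lookup π s F.≟ t ⌋)
      ≡⟨ sym (matrixList-permMatrix π) ⟩
    matrixList (permMatrix π) ∎)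
  where
  open ≡-Reasoning
  dots : ∀ s t → ⌊ lookup σ (lookup rows s) F.≟ lookup cols t ⌋ ≡ ⌊ lookup π s F.≟ t ⌋
  dots s t rewrite hits s = ⌊⌋-⇔ (lookup cols (lookup π s) F.≟ lookup cols t) (lookup π s F.≟ t)
                                 (Increasing3-injective cols cols-inc _ _) (cong (lookup cols))

record Occurrence (n : ℕ) (s : ℕ → ℕ) (Order : ℕ → ℕ → ℕ → Set) : Set where
  constructor occurrence
  field
    {i₀ i₁ i₂} : ℕ
    i₀<i₁     : i₀ < i₁
    i₁<i₂     : i₁ < i₂
    i₂<n      : i₂ < n
    order     : Order (s i₀) (s i₁) (s i₂)

Order123 Order231 Order312 : ℕ → ℕ → ℕ → Set
Order123 x y z = x < y × y < z
Order231 x y z = z < x × x < y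
Order312 x y z = y < z × z < x

π123 π231 π312 : Vec (Fin 3) 3
π123 = proj₂ p123
π231 = proj₂ p231
π312 = proj₂ p312

Embedding⇒Occurrence : ∀ {N} {σ : Vec (Fin N) N} {π : Vec (Fin 3) 3} {Order : ℕ → ℕ → ℕ → Set} →
  (∀ (v : Vec (Fin N) 3) → Increasing3 v → Order (toℕ (lookup v (lookup π F.zero)))
                                                  (toℕ (lookup v (lookup π (F.suc F.zero))))
                                                  (toℕ (lookup v (lookup π (F.suc (F.suc F.zero)))))) →
  Embedding σ π → Occurrence N (at σ) Order
Embedding⇒Occurrence {σ = σ} {π} {Order} increasing⇒order
                     (embedding rows@(r₀ ∷ r₁ ∷ r₂ ∷ []) cols (r₀<r₁ , r₁<r₂) cols-inc hits) =
  occurrence r₀<r₁ r₁<r₂ (FinP.toℕ<n r₂)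
    (subst₃ Order (value F.zero) (value (F.suc F.zero)) (value (F.suc (F.suc F.zero))) (increasing⇒order cols cols-inc))
  where
  value : ∀ t → toℕ (lookup cols (lookup π t)) ≡ at σ (toℕ (lookup rows t))
  value t = sym (trans (at-toℕ σ (lookup rows t)) (cong toℕ (hits t)))
  subst₃ : ∀ (R : ℕ → ℕ → ℕ → Set) {x x′ y y′ z z′} → x ≡ x′ → y ≡ y′ → z ≡ z′ → R x y z → R x′ y′ z′
  subst₃ R refl refl refl r = r

Contains⇒Occurrence123 : ∀ {N} (σ : Vec (Fin N) N) → Contains σ π123 → Occurrence N (at σ) Order123
Contains⇒Occurrence123 σ c = Embedding⇒Occurrence (λ { (_ ∷ _ ∷ _ ∷ []) (a<b , b<c) → a<b , b<c })
                                                  (Contains⇒Embedding σ π123 c)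

Contains⇒Occurrence231 : ∀ {N} (σ : Vec (Fin N) N) → Contains σ π231 → Occurrence N (at σ) Order231
Contains⇒Occurrence231 σ c = Embedding⇒Occurrence (λ { (_ ∷ _ ∷ _ ∷ []) (a<b , b<c) → a<b , b<c })
                                                  (Contains⇒Embedding σ π231 c)

Contains⇒Occurrence312 : ∀ {N} (σ : Vec (Fin N) N) → Contains σ π312 → Occurrence N (at σ) Order312
Contains⇒Occurrence312 σ c = Embedding⇒Occurrence (λ { (_ ∷ _ ∷ _ ∷ []) (a<b , b<c) → a<b , b<c })
                                                  (Contains⇒Embedding σ π312 c)

module _ {N} (σ : Vec (Fin N) N) where

  private
    val : ∀ {i} → i < N → Fin N
    val i<N = lookup σ (fromℕ< i<N)

    fromℕ<-< : ∀ {i j} (i<N : i < N) (j<N : j < N) → i < j → fromℕ< i<N F.< fromℕ< j<N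
    fromℕ<-< i<N j<N i<j rewrite FinP.toℕ-fromℕ< i<N | FinP.toℕ-fromℕ< j<N = i<j

    val-< : ∀ {i j} (i<N : i < N) (j<N : j < N) → at σ i < at σ j → val i<N F.< val j<N
    val-< i<N j<N σi<σj rewrite at-fromℕ< σ i<N | at-fromℕ< σ j<N = σi<σj

  Occurrence123⇒Contains : Occurrence N (at σ) Order123 → Contains σ π123
  Occurrence123⇒Contains (occurrence i₀<i₁ i₁<i₂ i₂<N (v₀<v₁ , v₁<v₂)) = Embedding⇒Contains {σ = σ} {π = π123}
    (embedding (fromℕ< i₀<N ∷ fromℕ< i₁<N ∷ fromℕ< i₂<N ∷ []) (val i₀<N ∷ val i₁<N ∷ val i₂<N ∷ [])
               (fromℕ<-< i₀<N i₁<N i₀<i₁ , fromℕ<-< i₁<N i₂<N i₁<i₂)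
               (val-< i₀<N i₁<N v₀<v₁ , val-< i₁<N i₂<N v₁<v₂)
               λ { F.zero → refl ; (F.suc F.zero) → refl ; (F.suc (F.suc F.zero)) → refl })
    where i₁<N = <-trans i₁<i₂ i₂<N ; i₀<N = <-trans i₀<i₁ i₁<N

  Occurrence231⇒Contains : Occurrence N (at σ) Order231 → Contains σ π231
  Occurrence231⇒Contains (occurrence i₀<i₁ i₁<i₂ i₂<N (v₂<v₀ , v₀<v₁)) = Embedding⇒Contains {σ = σ} {π = π231}
    (embedding (fromℕ< i₀<N ∷ fromℕ< i₁<N ∷ fromℕ< i₂<N ∷ []) (val i₂<N ∷ val i₀<N ∷ val i₁<N ∷ [])
               (fromℕ<-< i₀<N i₁<N i₀<i₁ , fromℕ<-< i₁<N i₂<N i₁<i₂)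
               (val-< i₂<N i₀<N v₂<v₀ , val-< i₀<N i₁<N v₀<v₁)
               λ { F.zero → refl ; (F.suc F.zero) → refl ; (F.suc (F.suc F.zero)) → refl })
    where i₁<N = <-trans i₁<i₂ i₂<N ; i₀<N = <-trans i₀<i₁ i₁<N

  Occurrence312⇒Contains : Occurrence N (at σ) Order312 → Contains σ π312
  Occurrence312⇒Contains (occurrence i₀<i₁ i₁<i₂ i₂<N (v₁<v₂ , v₂<v₀)) = Embedding⇒Contains {σ = σ} {π = π312}
    (embedding (fromℕ< i₀<N ∷ fromℕ< i₁<N ∷ fromℕ< i₂<N ∷ []) (val i₁<N ∷ val i₂<N ∷ val i₀<N ∷ [])
               (fromℕ<-< i₀<N i₁<N i₀<i₁ , fromℕ<-< i₁<N i₂<N i₁<i₂)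
               (val-< i₁<N i₂<N v₁<v₂ , val-< i₂<N i₀<N v₂<v₀)
               λ { F.zero → refl ; (F.suc F.zero) → refl ; (F.suc (F.suc F.zero)) → refl })
    where i₁<N = <-trans i₁<i₂ i₂<N ; i₀<N = <-trans i₀<i₁ i₁<N

-- Avoiders of 123 and 231 are layered

-- Writing s i + suc i ≡ K says that s is the decreasing run i ↦ K - 1 - i there: positions
-- [0, j) carry the values n-1, …, n-j, positions [j, j+a) the values a-1, …, 0 and
-- positions [j+a, n) the values n-j-1, …, a.
record Layered (n : ℕ) (s : ℕ → ℕ) : Set where
  constructor layered
  field
    j a    : ℕ
    j+a≤n  : j + a ≤ n
    top    : ∀ i → i < j → s i + suc i ≡ n
    middle : ∀ i → j ≤ i → i < j + a → s i + suc i ≡ j + a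
    bottom : ∀ i → j + a ≤ i → i < n → s i + suc i ≡ n + a

firstFailure : ∀ m (P : ℕ → Set) → (∀ i → Dec (P i)) →
               (∀ i → i < m → P i) ⊎ ∃ λ j → j < m × ¬ P j × (∀ i → i < j → P i)
firstFailure zero    P P? = inj₁ (λ i ())
firstFailure (suc m) P P? with firstFailure m P P?
... | inj₂ (j , j<m , ¬Pj , below) = inj₂ (j , m<n⇒m<1+n j<m , ¬Pj , below)
... | inj₁ all with P? m
...   | yes Pm  = inj₁ (λ i i<1+m → [ all i , (λ i≡m → subst P (sym i≡m) Pm) ] (m≤n⇒m<n∨m≡n (ℕ.s≤s⁻¹ i<1+m)))
...   | no ¬Pm  = inj₂ (m , ≤-refl , ¬Pm , all)

decreasing-run : ∀ (s : ℕ → ℕ) lo k → (∀ x → lo ≤ x → x < lo + k → s (suc x) < s x) → s (lo + k) + k ≤ s lo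
decreasing-run s lo zero    _    rewrite +-identityʳ lo | +-identityʳ (s lo) = ≤-refl
decreasing-run s lo (suc k) desc = subst (λ z → s z + suc k ≤ s lo) (sym lo+1+k≡1+lo+k)
  (≤-trans (subst (_≤ s (lo + k) + k) (sym (+-suc (s (suc (lo + k))) k)) (+-monoˡ-≤ k last-step))
           (decreasing-run s lo k (λ x lo≤x x<lo+k → desc x lo≤x (<-trans x<lo+k lo+k<lo+1+k))))
  where
  lo+1+k≡1+lo+k = +-suc lo k
  lo+k<lo+1+k : lo + k < lo + suc k
  lo+k<lo+1+k = subst (lo + k <_) (sym lo+1+k≡1+lo+k) ≤-refl
  last-step : s (suc (lo + k)) < s (lo + k)
  last-step = desc (lo + k) (m≤m+n lo k) lo+k<lo+1+k

x+[1+y+z]≡[x+z]+[1+y] : ∀ x y z → x + suc (y + z) ≡ (x + z) + suc y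
x+[1+y+z]≡[x+z]+[1+y] = solve-∀

x+[1+y]≡y+[1+x] : ∀ x y → x + suc y ≡ y + suc x
x+[1+y]≡y+[1+x] = solve-∀

module AvoiderStructure
  (n : ℕ) (s : ℕ → ℕ)
  (s-bounded    : ∀ i → i < n → s i < n)
  (s-injective  : ∀ i i′ → i < n → i′ < n → s i ≡ s i′ → i ≡ i′)
  (s-surjective : ∀ v → v < n → ∃ λ i → i < n × s i ≡ v)
  (avoids123    : ¬ Occurrence n s Order123)
  (avoids231    : ¬ Occurrence n s Order231) where

  private
    compare : ∀ i i′ → i < n → i′ < n → i ≢ i′ → s i < s i′ ⊎ s i′ < s i
    compare i i′ i<n i′<n i≢i′ with <-cmp (s i) (s i′)
    ... | tri< lt _ _ = inj₁ lt
    ... | tri≈ _ eq _ = contradiction (s-injective i i′ i<n i′<n eq) i≢i′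
    ... | tri> _ _ gt = inj₂ gt

  -- j is the first position that is not on the top run; the value n - 1 - j it misses sits at
  -- the pivot, which starts the bottom run and ends the middle one.
  module Pivot (j : ℕ) (j<n : j < n) (j-off-top : s j + suc j ≢ n) (top : ∀ i → i < j → s i + suc i ≡ n) where

    pivotValue : ℕ
    pivotValue = n ∸ suc j

    pivotValue+1+j≡n : pivotValue + suc j ≡ n
    pivotValue+1+j≡n = m∸n+n≡m j<n

    pivotValue<n : pivotValue < n
    pivotValue<n = <-≤-trans (m<m+n pivotValue (s≤s z≤n)) (subst (pivotValue + 1 ≤_) pivotValue+1+j≡n (+-monoʳ-≤ pivotValue (s≤s z≤n)))

    value≤pivotValue : ∀ i → j ≤ i → i < n → s i + suc j ≤ n
    value≤pivotValue i j≤i i<n with s i + suc j ℕ.≤? n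
    ... | yes ok = ok
    ... | no too-big = contradiction t≡i (<⇒≢ (<-≤-trans t<j j≤i))
      where
      t = n ∸ suc (s i)
      t+1+si≡n : t + suc (s i) ≡ n
      t+1+si≡n = m∸n+n≡m (s-bounded i i<n)
      t<j : t < j
      t<j = +-cancelʳ-≤ (s i) (suc t) j (subst (_≤ j + s i) (sym (trans (sym (+-suc t (s i))) t+1+si≡n))
              (subst (n ≤_) (+-comm (s i) j) (ℕ.s≤s⁻¹ (subst (suc n ≤_) (+-suc (s i) j) (≰⇒> too-big)))))
      t≡i : t ≡ i
      t≡i = s-injective t i (<-trans t<j j<n) i<n
              (+-cancelʳ-≡ (suc t) (s t) (s i) (trans (top t t<j) (sym (trans (x+[1+y]≡y+[1+x] (s i) t) t+1+si≡n))))

    pivot : ℕ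
    pivot = proj₁ (s-surjective pivotValue pivotValue<n)

    pivot<n : pivot < n
    pivot<n = proj₁ (proj₂ (s-surjective pivotValue pivotValue<n))

    s-pivot : s pivot ≡ pivotValue
    s-pivot = proj₂ (proj₂ (s-surjective pivotValue pivotValue<n))

    j<pivot : j < pivot
    j<pivot with <-cmp j pivot
    ... | tri< j<p _ _ = j<p
    ... | tri≈ _ j≡p _ = contradiction (subst (λ x → s x + suc x ≡ n) (sym j≡p)
                            (subst (λ v → v + suc pivot ≡ n) (sym s-pivot) (subst (λ x → pivotValue + suc x ≡ n) j≡p pivotValue+1+j≡n)))
                            j-off-top
    ... | tri> _ _ p<j = contradiction p≡j (<⇒≢ p<j)
      where
      p≡j : pivot ≡ j
      p≡j = suc-injective (+-cancelˡ-≡ pivotValue (suc pivot) (suc j)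
              (trans (subst (λ v → v + suc pivot ≡ n) s-pivot (top pivot p<j)) (sym pivotValue+1+j≡n)))

    a₀ : ℕ
    a₀ = pivot ∸ suc j

    j+1+a₀≡pivot : j + suc a₀ ≡ pivot
    j+1+a₀≡pivot = trans (+-suc j a₀) (m+[n∸m]≡n j<pivot)

    1+j+a₀≡pivot : suc (j + a₀) ≡ pivot
    1+j+a₀≡pivot = trans (sym (+-suc j a₀)) j+1+a₀≡pivot

    value<pivotValue : ∀ i → j ≤ i → i < n → i ≢ pivot → s i < pivotValue
    value<pivotValue i j≤i i<n i≢p =
      ≤∧≢⇒< (+-cancelʳ-≤ (suc j) (s i) pivotValue (subst (s i + suc j ≤_) (sym pivotValue+1+j≡n) (value≤pivotValue i j≤i i<n)))
            (λ si≡v → i≢p (s-injective i pivot i<n pivot<n (trans si≡v (sym s-pivot))))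

    middle-decreasing : ∀ x → j ≤ x → suc x < pivot → s (suc x) < s x
    middle-decreasing x j≤x 1+x<p with compare x (suc x) (<-trans (n<1+n x) (<-trans 1+x<p pivot<n)) (<-trans 1+x<p pivot<n) (<⇒≢ (n<1+n x))
    ... | inj₂ ok = ok
    ... | inj₁ up = contradiction (occurrence (n<1+n x) 1+x<p pivot<n
                      (up , subst (s (suc x) <_) (sym s-pivot)
                              (value<pivotValue (suc x) (m≤n⇒m≤1+n j≤x) (<-trans 1+x<p pivot<n) (<⇒≢ 1+x<p))))
                      avoids123

    middle<bottom : ∀ i i′ → j ≤ i → i < pivot → pivot < i′ → i′ < n → s i < s i′
    middle<bottom i i′ j≤i i<p p<i′ i′<n with compare i i′ (<-trans i<p pivot<n) i′<n (<⇒≢ (<-trans i<p p<i′))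
    ... | inj₁ ok   = ok
    ... | inj₂ down = contradiction (occurrence i<p p<i′ i′<n
                        (down , subst (s i <_) (sym s-pivot) (value<pivotValue i j≤i (<-trans i<p pivot<n) (<⇒≢ i<p))))
                        avoids231

    bottom-decreasing : ∀ x → pivot ≤ x → suc x < n → s (suc x) < s x
    bottom-decreasing x p≤x 1+x<n with m≤n⇒m<n∨m≡n p≤x
    ... | inj₂ refl = subst (s (suc pivot) <_) (sym s-pivot)
                        (value<pivotValue (suc pivot) (m≤n⇒m≤1+n (<⇒≤ j<pivot)) 1+x<n (≢-sym (<⇒≢ (n<1+n pivot))))
    ... | inj₁ p<x with compare x (suc x) (<-trans (n<1+n x) 1+x<n) 1+x<n (<⇒≢ (n<1+n x))
    ...   | inj₂ ok = ok
    ...   | inj₁ up = contradiction (occurrence (<-trans j<pivot p<x) (n<1+n x) 1+x<n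
                        (middle<bottom j x ≤-refl j<pivot p<x (<-trans (n<1+n x) 1+x<n) , up))
                        avoids123

    last : ℕ
    last = n ∸ 1

    1+last≡n : suc last ≡ n
    1+last≡n = trans (+-comm 1 last) (m∸n+n≡m (≤-trans (s≤s z≤n) pivot<n))

    last<n : last < n
    last<n = subst (last <_) 1+last≡n ≤-refl

    a₀≤s-j : a₀ ≤ s j
    a₀≤s-j = m+n≤o⇒n≤o (s (j + a₀)) (decreasing-run s j a₀ λ x j≤x x<j+a₀ →
               middle-decreasing x j≤x (subst (suc (suc x) ≤_) 1+j+a₀≡pivot (s≤s x<j+a₀)))

    pivotValue+1+pivot≡n+1+a₀ : pivotValue + suc pivot ≡ n + suc a₀
    pivotValue+1+pivot≡n+1+a₀ = begin
      pivotValue + suc pivot              ≡⟨ cong (λ x → pivotValue + suc x) (sym j+1+a₀≡pivot) ⟩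
      pivotValue + suc (j + suc a₀)       ≡⟨ x+[1+y+z]≡[x+z]+[1+y] pivotValue j (suc a₀) ⟩
      (pivotValue + suc a₀) + suc j       ≡⟨ +-assoc pivotValue (suc a₀) (suc j) ⟩
      pivotValue + (suc a₀ + suc j)       ≡⟨ cong (pivotValue +_) (+-comm (suc a₀) (suc j)) ⟩
      pivotValue + (suc j + suc a₀)       ≡⟨ sym (+-assoc pivotValue (suc j) (suc a₀)) ⟩
      (pivotValue + suc j) + suc a₀       ≡⟨ cong (_+ suc a₀) pivotValue+1+j≡n ⟩
      n + suc a₀                          ∎
      where open ≡-Reasoning

    bottom-shape≤ : ∀ k → pivot + k < n → s (pivot + k) + suc (pivot + k) ≤ n + suc a₀
    bottom-shape≤ k p+k<n = begin
      s (pivot + k) + suc (pivot + k)     ≡⟨ x+[1+y+z]≡[x+z]+[1+y] (s (pivot + k)) pivot k ⟩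
      (s (pivot + k) + k) + suc pivot     ≤⟨ +-monoˡ-≤ (suc pivot) (decreasing-run s pivot k λ x p≤x x<p+k →
                                               bottom-decreasing x p≤x (≤-trans (s≤s x<p+k) p+k<n)) ⟩
      s pivot + suc pivot                 ≡⟨ cong (_+ suc pivot) s-pivot ⟩
      pivotValue + suc pivot              ≡⟨ pivotValue+1+pivot≡n+1+a₀ ⟩
      n + suc a₀                          ∎
      where open ≤-Reasoning

    bottom-shape≥ : ∀ i → pivot < i → i < n → n + suc a₀ ≤ s i + suc i
    bottom-shape≥ i p<i i<n = begin
      n + suc a₀                          ≤⟨ +-monoʳ-≤ n (≤-<-trans a₀≤s-j
                                               (middle<bottom j last ≤-refl j<pivot (<-≤-trans p<i i≤last) last<n)) ⟩
      n + s last                          ≡⟨ +-comm n (s last) ⟩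
      s last + n                          ≡⟨ cong (s last +_) (sym 1+last≡n) ⟩
      s last + suc last                   ≡⟨ cong (λ x → s x + suc x) (sym i+k≡last) ⟩
      s (i + k) + suc (i + k)             ≡⟨ x+[1+y+z]≡[x+z]+[1+y] (s (i + k)) i k ⟩
      (s (i + k) + k) + suc i             ≤⟨ +-monoˡ-≤ (suc i) (decreasing-run s i k λ x i≤x x<i+k →
                                               bottom-decreasing x (<⇒≤ (<-≤-trans p<i i≤x))
                                                 (subst (suc (suc x) ≤_) 1+last≡n (s≤s (subst (suc x ≤_) i+k≡last x<i+k)))) ⟩
      s i + suc i                         ∎
      where
      open ≤-Reasoning
      i≤last : i ≤ last
      i≤last = ℕ.s≤s⁻¹ (subst (suc i ≤_) (sym 1+last≡n) i<n)
      k = last ∸ i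
      i+k≡last : i + k ≡ last
      i+k≡last = m+[n∸m]≡n i≤last

    bottom-shape : ∀ i → pivot ≤ i → i < n → s i + suc i ≡ n + suc a₀
    bottom-shape i p≤i i<n with m≤n⇒m<n∨m≡n p≤i
    ... | inj₂ refl = trans (cong (_+ suc pivot) s-pivot) pivotValue+1+pivot≡n+1+a₀
    ... | inj₁ p<i  = ≤-antisym
      (subst (λ x → s x + suc x ≤ n + suc a₀) (m+[n∸m]≡n p≤i) (bottom-shape≤ (i ∸ pivot) (subst (_< n) (sym (m+[n∸m]≡n p≤i)) i<n)))
      (bottom-shape≥ i p<i i<n)

    s-j≤a₀ : s j ≤ a₀
    s-j≤a₀ with pivot ℕ.≟ last
    ... | yes p≡last = ℕ.s≤s⁻¹ (subst (s j <_) pivotValue≡1+a₀ (value<pivotValue j ≤-refl j<n (<⇒≢ j<pivot)))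
      where
      pivotValue≡1+a₀ : pivotValue ≡ suc a₀
      pivotValue≡1+a₀ = +-cancelʳ-≡ (suc j) pivotValue (suc a₀) (begin
        pivotValue + suc j     ≡⟨ pivotValue+1+j≡n ⟩
        n                      ≡⟨ sym 1+last≡n ⟩
        suc last               ≡⟨ cong suc (trans (sym p≡last) (sym j+1+a₀≡pivot)) ⟩
        suc (j + suc a₀)       ≡⟨ cong suc (x+[1+y]≡y+[1+x] j a₀) ⟩
        suc a₀ + suc j         ∎)
        where open ≡-Reasoning
    ... | no p≢last = ℕ.s≤s⁻¹ (subst (s j <_) s-last≡1+a₀ (middle<bottom j last ≤-refl j<pivot p<last last<n))
      where
      p<last : pivot < last
      p<last = ≤∧≢⇒< (ℕ.s≤s⁻¹ (subst (suc pivot ≤_) (sym 1+last≡n) pivot<n)) p≢last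
      s-last≡1+a₀ : s last ≡ suc a₀
      s-last≡1+a₀ = +-cancelʳ-≡ n (s last) (suc a₀)
        (trans (cong (s last +_) (sym 1+last≡n)) (trans (bottom-shape last (<⇒≤ p<last) last<n) (+-comm n (suc a₀))))

    middle-shape : ∀ i → j ≤ i → i < pivot → s i + suc i ≡ pivot
    middle-shape i j≤i i<p = ≤-antisym upper lower
      where
      k = i ∸ j
      j+k≡i : j + k ≡ i
      j+k≡i = m+[n∸m]≡n j≤i
      upper : s i + suc i ≤ pivot
      upper = begin
        s i + suc i               ≡⟨ cong (λ x → s x + suc x) (sym j+k≡i) ⟩
        s (j + k) + suc (j + k)   ≡⟨ x+[1+y+z]≡[x+z]+[1+y] (s (j + k)) j k ⟩
        (s (j + k) + k) + suc j   ≤⟨ +-monoˡ-≤ (suc j) (decreasing-run s j k λ x j≤x x<j+k →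
                                       middle-decreasing x j≤x (≤-<-trans (subst (suc x ≤_) j+k≡i x<j+k) i<p)) ⟩
        s j + suc j               ≤⟨ +-monoˡ-≤ (suc j) s-j≤a₀ ⟩
        a₀ + suc j                ≡⟨ x+[1+y]≡y+[1+x] a₀ j ⟩
        j + suc a₀                ≡⟨ j+1+a₀≡pivot ⟩
        pivot                     ∎
        where open ≤-Reasoning
      i≤j+a₀ : i ≤ j + a₀
      i≤j+a₀ = ℕ.s≤s⁻¹ (subst (suc i ≤_) (sym 1+j+a₀≡pivot) i<p)
      k′ = (j + a₀) ∸ i
      i+k′≡j+a₀ : i + k′ ≡ j + a₀
      i+k′≡j+a₀ = m+[n∸m]≡n i≤j+a₀
      lower : pivot ≤ s i + suc i
      lower = begin
        pivot                     ≡⟨ sym 1+j+a₀≡pivot ⟩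
        suc (j + a₀)              ≡⟨ cong suc (sym i+k′≡j+a₀) ⟩
        suc (i + k′)              ≡⟨ sym (+-suc i k′) ⟩
        i + suc k′                ≡⟨ x+[1+y]≡y+[1+x] i k′ ⟩
        k′ + suc i                ≤⟨ +-monoˡ-≤ (suc i) (m+n≤o⇒n≤o (s (i + k′)) (decreasing-run s i k′ λ x i≤x x<i+k′ →
                                       middle-decreasing x (≤-trans j≤i i≤x)
                                         (subst (suc (suc x) ≤_) 1+j+a₀≡pivot (s≤s (subst (suc x ≤_) i+k′≡j+a₀ x<i+k′))))) ⟩
        s i + suc i               ∎
        where open ≤-Reasoning

  avoider-Layered : Layered n s
  avoider-Layered with firstFailure n (λ i → s i + suc i ≡ n) (λ i → s i + suc i ℕ.≟ n)
  ... | inj₁ all-top = layered n 0 (≤-reflexive (+-identityʳ n)) all-top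
        (λ i n≤i i<n+0 → contradiction (subst (i <_) (+-identityʳ n) i<n+0) (≤⇒≯ n≤i))
        (λ i n+0≤i i<n → contradiction i<n (≤⇒≯ (subst (_≤ i) (+-identityʳ n) n+0≤i)))
  ... | inj₂ (j , j<n , j-off-top , top) =
        layered j (suc a₀) (subst (_≤ n) (sym j+1+a₀≡pivot) (<⇒≤ pivot<n)) top
          (λ i j≤i i<j+1+a₀ → trans (middle-shape i j≤i (subst (i <_) j+1+a₀≡pivot i<j+1+a₀)) (sym j+1+a₀≡pivot))
          (λ i j+1+a₀≤i i<n → bottom-shape i (subst (_≤ i) j+1+a₀≡pivot j+1+a₀≤i) i<n)
    where open Pivot j j<n j-off-top top

Layered-cong : ∀ {n} {s s′ : ℕ → ℕ} → (∀ i → i < n → s i ≡ s′ i) → Layered n s → Layered n s′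
Layered-cong {n} s≗s′ (layered j a j+a≤n top middle bottom) = layered j a j+a≤n
  (λ i i<j → subst (λ v → v + suc i ≡ n) (s≗s′ i (<-≤-trans i<j (m+n≤o⇒m≤o j j+a≤n))) (top i i<j))
  (λ i j≤i i<j+a → subst (λ v → v + suc i ≡ j + a) (s≗s′ i (<-≤-trans i<j+a j+a≤n)) (middle i j≤i i<j+a))
  (λ i j+a≤i i<n → subst (λ v → v + suc i ≡ n + a) (s≗s′ i i<n) (bottom i j+a≤i i<n))

Layered-unique : ∀ {n} {s s′ : ℕ → ℕ} (L : Layered n s) (L′ : Layered n s′) →
                 Layered.j L ≡ Layered.j L′ → Layered.a L ≡ Layered.a L′ → ∀ i → i < n → s i ≡ s′ i
Layered-unique {n} {s} {s′} (layered j a _ top middle bottom) (layered .j .a _ top′ middle′ bottom′) refl refl i i<n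
  with i ℕ.<? j
... | yes i<j = +-cancelʳ-≡ (suc i) (s i) (s′ i) (trans (top i i<j) (sym (top′ i i<j)))
... | no i≮j with i ℕ.<? j + a
...   | yes i<j+a = +-cancelʳ-≡ (suc i) (s i) (s′ i) (trans (middle i (≮⇒≥ i≮j) i<j+a) (sym (middle′ i (≮⇒≥ i≮j) i<j+a)))
...   | no i≮j+a  = +-cancelʳ-≡ (suc i) (s i) (s′ i) (trans (bottom i (≮⇒≥ i≮j+a) i<n) (sym (bottom′ i (≮⇒≥ i≮j+a) i<n)))

layers : ℕ → ℕ → ℕ → ℕ → ℕ
layers n j a i with i ℕ.<? j
... | yes _ = n ∸ suc i
... | no _ with i ℕ.<? j + a
...   | yes _ = (j + a) ∸ suc i
...   | no _  = (n + a) ∸ suc i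

layers-Layered : ∀ n j a → j + a ≤ n → Layered n (layers n j a)
layers-Layered n j a j+a≤n = layered j a j+a≤n top middle bottom
  where
  top : ∀ i → i < j → layers n j a i + suc i ≡ n
  top i i<j with i ℕ.<? j
  ... | yes _   = m∸n+n≡m (≤-trans i<j (m+n≤o⇒m≤o j j+a≤n))
  ... | no i≮j  = contradiction i<j i≮j
  middle : ∀ i → j ≤ i → i < j + a → layers n j a i + suc i ≡ j + a
  middle i j≤i i<j+a with i ℕ.<? j
  ... | yes i<j = contradiction j≤i (<⇒≱ i<j)
  ... | no _ with i ℕ.<? j + a
  ...   | yes _    = m∸n+n≡m i<j+a
  ...   | no i≮j+a = contradiction i<j+a i≮j+a
  bottom : ∀ i → j + a ≤ i → i < n → layers n j a i + suc i ≡ n + a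
  bottom i j+a≤i i<n with i ℕ.<? j
  ... | yes i<j = contradiction j+a≤i (<⇒≱ (<-≤-trans i<j (m≤m+n j a)))
  ... | no _ with i ℕ.<? j + a
  ...   | yes i<j+a = contradiction j+a≤i (<⇒≱ i<j+a)
  ...   | no _      = m∸n+n≡m (≤-trans i<n (m≤m+n n a))

module LayeredProperties {n : ℕ} {s : ℕ → ℕ} (L : Layered n s) where
  open Layered L

  top-high : ∀ i → i < j → n ≤ s i + j
  top-high i i<j = subst (_≤ s i + j) (top i i<j) (+-monoʳ-≤ (s i) i<j)

  middle-low : ∀ i → j ≤ i → i < j + a → s i < a
  middle-low i j≤i i<j+a = +-cancelˡ-< j (s i) a
    (subst (j + s i <_) (middle i j≤i i<j+a) (subst (_< s i + suc i) (+-comm (s i) j) (+-monoʳ-< (s i) (s≤s j≤i))))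

  bottom-≥a : ∀ i → j + a ≤ i → i < n → a ≤ s i
  bottom-≥a i j+a≤i i<n = +-cancelˡ-≤ n a (s i)
    (subst (n + a ≤_) (+-comm (s i) n) (subst (_≤ s i + n) (bottom i j+a≤i i<n) (+-monoʳ-≤ (s i) i<n)))

  bottom-below-top : ∀ i → j + a ≤ i → i < n → s i + j < n
  bottom-below-top i j+a≤i i<n = +-cancelʳ-< a (s i + j) n
    (subst (s i + j + a <_) (bottom i j+a≤i i<n) (subst (_< s i + suc i) (sym (+-assoc (s i) j a)) (+-monoʳ-< (s i) (s≤s j+a≤i))))

  no-middle⇒top : a ≡ 0 ⊎ j + a ≡ n → ∀ i → i < n → s i + suc i ≡ n
  no-middle⇒top no-middle i i<n with i ℕ.<? j | no-middle
  ... | yes i<j | _          = top i i<j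
  ... | no i≮j  | inj₁ refl  = trans (bottom i (subst (_≤ i) (sym (+-identityʳ j)) (≮⇒≥ i≮j)) i<n) (+-identityʳ n)
  ... | no i≮j  | inj₂ j+a≡n = trans (middle i (≮⇒≥ i≮j) (subst (i <_) (sym j+a≡n) i<n)) j+a≡n

  private
    run-decreasing : ∀ i i′ K → i < i′ → s i + suc i ≡ K → s i′ + suc i′ ≡ K → s i′ < s i
    run-decreasing i i′ K i<i′ e e′ = +-cancelʳ-< (suc i) (s i′) (s i)
      (subst (s i′ + suc i <_) (trans e′ (sym e)) (+-monoʳ-< (s i′) (s≤s i<i′)))

  descent-or-middle-bottom : ∀ i i′ → i < i′ → i′ < n → s i′ < s i ⊎ (j ≤ i × i < j + a × j + a ≤ i′)
  descent-or-middle-bottom i i′ i<i′ i′<n with i ℕ.<? j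
  ... | yes i<j with i′ ℕ.<? j
  ...   | yes i′<j = inj₁ (run-decreasing i i′ n i<i′ (top i i<j) (top i′ i′<j))
  ...   | no i′≮j  = inj₁ (+-cancelʳ-< j (s i′) (s i) (<-≤-trans s-i′+j<n (top-high i i<j)))
    where
    s-i′+j<n : s i′ + j < n
    s-i′+j<n with i′ ℕ.<? j + a
    ... | yes i′<j+a = <-≤-trans (+-monoˡ-< j (middle-low i′ (≮⇒≥ i′≮j) i′<j+a)) (subst (_≤ n) (+-comm j a) j+a≤n)
    ... | no i′≮j+a  = bottom-below-top i′ (≮⇒≥ i′≮j+a) i′<n
  descent-or-middle-bottom i i′ i<i′ i′<n | no i≮j with i ℕ.<? j + a
  ...   | no i≮j+a = inj₁ (run-decreasing i i′ (n + a) i<i′ (bottom i (≮⇒≥ i≮j+a) (<-trans i<i′ i′<n))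
                                                       (bottom i′ (≤-trans (≮⇒≥ i≮j+a) (<⇒≤ i<i′)) i′<n))
  ...   | yes i<j+a with i′ ℕ.<? j + a
  ...     | yes i′<j+a = inj₁ (run-decreasing i i′ (j + a) i<i′ (middle i (≮⇒≥ i≮j) i<j+a)
                                                           (middle i′ (≤-trans (≮⇒≥ i≮j) (<⇒≤ i<i′)) i′<j+a))
  ...     | no i′≮j+a  = inj₂ (≮⇒≥ i≮j , i<j+a , ≮⇒≥ i′≮j+a)

  bounded : ∀ i → i < n → s i < n
  bounded i i<n with i ℕ.<? j
  ... | yes i<j = subst (s i <_) (top i i<j) (m<m+n (s i) (s≤s z≤n))
  ... | no i≮j with i ℕ.<? j + a
  ...   | yes i<j+a = ≤-trans (subst (s i <_) (middle i (≮⇒≥ i≮j) i<j+a) (m<m+n (s i) (s≤s z≤n))) j+a≤n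
  ...   | no i≮j+a  = ≤-<-trans (m≤m+n (s i) j) (bottom-below-top i (≮⇒≥ i≮j+a) i<n)

  private
    ≢-ordered : ∀ i i′ → i < i′ → i′ < n → s i ≢ s i′
    ≢-ordered i i′ i<i′ i′<n si≡si′ with descent-or-middle-bottom i i′ i<i′ i′<n
    ... | inj₁ down = <-irrefl (sym si≡si′) down
    ... | inj₂ (j≤i , i<j+a , j+a≤i′) = <-irrefl si≡si′ (<-≤-trans (middle-low i j≤i i<j+a) (bottom-≥a i′ j+a≤i′ i′<n))

  injective : ∀ i i′ → i < n → i′ < n → s i ≡ s i′ → i ≡ i′
  injective i i′ i<n i′<n si≡si′ with <-cmp i i′
  ... | tri< i<i′ _ _ = contradiction si≡si′ (≢-ordered i i′ i<i′ i′<n)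
  ... | tri≈ _ i≡i′ _ = i≡i′
  ... | tri> _ _ i′<i = contradiction (sym si≡si′) (≢-ordered i′ i i′<i i<n)

  avoids123 : ¬ Occurrence n s Order123
  avoids123 (occurrence i₀<i₁ i₁<i₂ i₂<n (up₀₁ , up₁₂))
    with descent-or-middle-bottom _ _ i₀<i₁ (<-trans i₁<i₂ i₂<n) | descent-or-middle-bottom _ _ i₁<i₂ i₂<n
  ... | inj₁ down | _         = <-asym down up₀₁
  ... | inj₂ _    | inj₁ down = <-asym down up₁₂
  ... | inj₂ (_ , _ , j+a≤i₁) | inj₂ (_ , i₁<j+a , _) = <⇒≱ i₁<j+a j+a≤i₁

  avoids231 : ¬ Occurrence n s Order231
  avoids231 (occurrence i₀<i₁ i₁<i₂ i₂<n (down₀₂ , up₀₁)) with descent-or-middle-bottom _ _ i₀<i₁ (<-trans i₁<i₂ i₂<n)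
  ... | inj₁ down = <-asym down up₀₁
  ... | inj₂ (j≤i₀ , i₀<j+a , j+a≤i₁) =
        <⇒≱ down₀₂ (<⇒≤ (<-≤-trans (middle-low _ j≤i₀ i₀<j+a) (bottom-≥a _ (≤-trans j+a≤i₁ (<⇒≤ i₁<i₂)) i₂<n)))

-- Parametrising the corners

fromFunction : ∀ n (f : ℕ → ℕ) → (∀ i → i < n → f i < n) → Vec (Fin n) n
fromFunction n f f-bounded = tabulate (λ i → fromℕ< (f-bounded (toℕ i) (FinP.toℕ<n i)))

at-fromFunction : ∀ n f f-bounded i → i < n → at (fromFunction n f f-bounded) i ≡ f i
at-fromFunction n f f-bounded i i<n = begin
  at (fromFunction n f f-bounded) i                         ≡⟨ at-fromℕ< _ i<n ⟩
  toℕ (lookup (fromFunction n f f-bounded) (fromℕ< i<n))    ≡⟨ cong toℕ (VecP.lookup∘tabulate _ (fromℕ< i<n)) ⟩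
  toℕ (fromℕ< (f-bounded _ (FinP.toℕ<n (fromℕ< i<n))))      ≡⟨ FinP.toℕ-fromℕ< _ ⟩
  f (toℕ (fromℕ< i<n))                                      ≡⟨ cong f (FinP.toℕ-fromℕ< i<n) ⟩
  f i                                                       ∎
  where open ≡-Reasoning

-- Corners of {123, 231}-avoiders, indexed by the middle run [j, j + a) of a layered extension:
-- no run, a run of length a ≤ c or a = c + u - w > c starting at j = r + k resp. j = r + w, or a
-- run of length a ≤ d starting at j < r.  There are 1 + dc + d(d-1)/2 + rd of them, a count
-- symmetric in c and r.
data Param (d c r : ℕ) : Set where
  reversal : Param d c r
  shortRun : (k : Fin d) (y : Fin c) → Param d c r
  longRun  : (u : Fin d) (w : Fin (toℕ u)) → Param d c r
  earlyRun : (j : Fin r) (y : Fin d) → Param d c r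

swapParam : ∀ {d c r} → Param d c r → Param d r c
swapParam reversal       = reversal
swapParam (shortRun k y) = earlyRun y k
swapParam (longRun u w)  = longRun u w
swapParam (earlyRun j y) = shortRun y j

swapParam-involutive : ∀ {d c r} (p : Param d c r) → swapParam (swapParam p) ≡ p
swapParam-involutive reversal       = refl
swapParam-involutive (shortRun k y) = refl
swapParam-involutive (longRun u w)  = refl
swapParam-involutive (earlyRun j y) = refl

module Extension (d c r : ℕ) where

  n : ℕ
  n = d + c + r

  runStart runLength : Param d c r → ℕ
  runStart reversal       = n
  runStart (shortRun k y) = toℕ k + r
  runStart (longRun u w)  = toℕ w + r
  runStart (earlyRun j y) = toℕ j
  runLength reversal       = 0
  runLength (shortRun k y) = suc (toℕ y)
  runLength (longRun u w)  = c + (toℕ u ∸ toℕ w)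
  runLength (earlyRun j y) = suc (toℕ y)

  runEnd≤n : ∀ p → runStart p + runLength p ≤ n
  runEnd≤n reversal       = ≤-reflexive (+-identityʳ n)
  runEnd≤n (shortRun k y) = begin
    toℕ k + r + suc (toℕ y)                ≤⟨ +-mono-≤ (+-monoˡ-≤ r (<⇒≤ (FinP.toℕ<n k))) (FinP.toℕ<n y) ⟩
    d + r + c                              ≡⟨ sym (d+c+r≡d+r+c d c r) ⟩
    n                                      ∎
    where open ≤-Reasoning
  runEnd≤n (longRun u w)  = begin
    toℕ w + r + (c + (toℕ u ∸ toℕ w))      ≡⟨ rearrange (toℕ w) r c (toℕ u ∸ toℕ w) ⟩
    r + c + (toℕ w + (toℕ u ∸ toℕ w))      ≡⟨ cong (r + c +_) (m+[n∸m]≡n (<⇒≤ (FinP.toℕ<n w))) ⟩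
    r + c + toℕ u                          ≤⟨ +-monoʳ-≤ (r + c) (<⇒≤ (FinP.toℕ<n u)) ⟩
    r + c + d                              ≡⟨ reverse d c r ⟩
    n                                      ∎
    where
    open ≤-Reasoning
    rearrange : ∀ w r c x → w + r + (c + x) ≡ r + c + (w + x)
    rearrange = solve-∀
    reverse : ∀ d c r → r + c + d ≡ d + c + r
    reverse = solve-∀
  runEnd≤n (earlyRun j y) = begin
    toℕ j + suc (toℕ y)                    ≤⟨ +-mono-≤ (<⇒≤ (FinP.toℕ<n j)) (FinP.toℕ<n y) ⟩
    r + d                                  ≤⟨ m≤n+m (r + d) c ⟩
    c + (r + d)                            ≡⟨ rotate d c r ⟩
    n                                      ∎
    where
    open ≤-Reasoning
    rotate : ∀ d c r → c + (r + d) ≡ d + c + r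
    rotate = solve-∀

  shape : Param d c r → ℕ → ℕ
  shape p = layers n (runStart p) (runLength p)

  shape-Layered : ∀ p → Layered n (shape p)
  shape-Layered p = layers-Layered n (runStart p) (runLength p) (runEnd≤n p)

  extension : Param d c r → Vec (Fin n) n
  extension p = fromFunction n (shape p) (LayeredProperties.bounded (shape-Layered p))

  at-extension : ∀ p i → i < n → at (extension p) i ≡ shape p i
  at-extension p = at-fromFunction n (shape p) (LayeredProperties.bounded (shape-Layered p))

  extension-Layered : ∀ p → Layered n (at (extension p))
  extension-Layered p = Layered-cong (λ i i<n → sym (at-extension p i i<n)) (shape-Layered p)

module _ {n} (σ : Vec (Fin n) n) where

  Layered⇒IsPerm : Layered n (at σ) → IsPerm σ
  Layered⇒IsPerm L i i′ σi≡σi′ = FinP.toℕ-injective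
    (LayeredProperties.injective L (toℕ i) (toℕ i′) (FinP.toℕ<n i) (FinP.toℕ<n i′)
      (trans (at-toℕ σ i) (trans (cong toℕ σi≡σi′) (sym (at-toℕ σ i′)))))

  Layered⇒Avoids : Layered n (at σ) → Avoids σ τ₁
  Layered⇒Avoids L = (λ c → LayeredProperties.avoids123 L (Contains⇒Occurrence123 σ c))
                   ∷ (λ c → LayeredProperties.avoids231 L (Contains⇒Occurrence231 σ c))
                   ∷ []

  Avoids⇒Layered : IsPerm σ → Avoids σ τ₁ → Layered n (at σ)
  Avoids⇒Layered σ-perm (avoids123 ∷ avoids231 ∷ []) =
    AvoiderStructure.avoider-Layered n (at σ) (λ i → at<n σ) injective surjective
      (λ o → avoids123 (Occurrence123⇒Contains σ o)) (λ o → avoids231 (Occurrence231⇒Contains σ o))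
    where
    injective : ∀ i i′ → i < n → i′ < n → at σ i ≡ at σ i′ → i ≡ i′
    injective i i′ i<n i′<n σi≡σi′ = begin
      i                          ≡⟨ sym (FinP.toℕ-fromℕ< i<n) ⟩
      toℕ (fromℕ< i<n)           ≡⟨ cong toℕ (σ-perm _ _ (FinP.toℕ-injective
                                      (trans (sym (at-fromℕ< σ i<n)) (trans σi≡σi′ (at-fromℕ< σ i′<n))))) ⟩
      toℕ (fromℕ< i′<n)          ≡⟨ FinP.toℕ-fromℕ< i′<n ⟩
      i′                         ∎
      where open ≡-Reasoning
    surjective : ∀ v → v < n → ∃ λ i → i < n × at σ i ≡ v
    surjective v v<n with IsPerm⇒surjective σ σ-perm (fromℕ< v<n)
    ... | i , σi≡v = toℕ i , FinP.toℕ<n i , trans (at-toℕ σ i) (trans (cong toℕ σi≡v) (FinP.toℕ-fromℕ< v<n))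

-- Permutations with the same corner are exactly those whose values on the corner rows agree,
-- up to both leaving the corner's columns.
CornerAgree : (d c r : ℕ) → (ℕ → ℕ) → (ℕ → ℕ) → Set
CornerAgree d c r s s′ = ∀ i → i < d + r → s i ≡ s′ i ⊎ (d + c ≤ s i × d + c ≤ s′ i)

module _ (d c r : ℕ) where
  open Extension d c r

  d+r≤n : d + r ≤ n
  d+r≤n = +-monoˡ-≤ r (m≤m+n d c)

  agree-reversal : ∀ {s} → (∀ i → i < d + r → s i + suc i ≡ n) → CornerAgree d c r s (shape reversal)
  agree-reversal {s} s-top i i<d+r = inj₁ (+-cancelʳ-≡ (suc i) (s i) (shape reversal i)
    (trans (s-top i i<d+r) (sym (Layered.top (shape-Layered reversal) i (<-≤-trans i<d+r d+r≤n)))))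

  agree-exact : ∀ {s} (L : Layered n s) p → Layered.j L ≡ runStart p → Layered.a L ≡ runLength p →
                CornerAgree d c r s (shape p)
  agree-exact L p j≡ a≡ i i<d+r = inj₁ (Layered-unique L (shape-Layered p) j≡ a≡ i (<-≤-trans i<d+r d+r≤n))

  classify-lateRun : ∀ {s} (L : Layered n s) → let open Layered L in
                         r ≤ j → j < d + r → 0 < a → j + a < n → Σ (Param d c r) (λ p → CornerAgree d c r s (shape p))
  classify-lateRun L@(layered j (suc a₁) _ _ _ _) r≤j j<d+r _ j+a<n with a₁ ℕ.<? c
  ... | yes a₁<c = shortRun (fromℕ< k<d) (fromℕ< a₁<c) ,
                   agree-exact L (shortRun (fromℕ< k<d) (fromℕ< a₁<c))
                     (sym (trans (cong (_+ r) (FinP.toℕ-fromℕ< k<d)) k+r≡j)) (cong suc (sym (FinP.toℕ-fromℕ< a₁<c)))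
    where
    k = j ∸ r
    k+r≡j : k + r ≡ j
    k+r≡j = m∸n+n≡m r≤j
    k<d : k < d
    k<d = +-cancelʳ-< r k d (subst (_< d + r) (sym k+r≡j) j<d+r)
  ... | no a₁≮c = longRun (fromℕ< u<d) (fromℕ< k<u) , agree-exact L (longRun (fromℕ< u<d) (fromℕ< k<u)) j≡start a≡length
    where
    k = j ∸ r
    k+r≡j : k + r ≡ j
    k+r≡j = m∸n+n≡m r≤j
    c+[a₁∸c]≡a₁ : c + (a₁ ∸ c) ≡ a₁
    c+[a₁∸c]≡a₁ = m+[n∸m]≡n (≮⇒≥ a₁≮c)
    u = k + suc (a₁ ∸ c)
    u<d : u < d
    u<d = +-cancelʳ-< c u d (subst (_< d + c) (rearrange k c (a₁ ∸ c)) (+-cancelʳ-< r _ (d + c)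
            (subst (_< d + c + r) (trans (cong (λ x → k + r + suc x) (sym c+[a₁∸c]≡a₁)) (swap k r _))
              (subst (λ x → x + suc a₁ < n) (sym k+r≡j) j+a<n))))
      where
      rearrange : ∀ k c x → k + suc (c + x) ≡ k + suc x + c
      rearrange = solve-∀
      swap : ∀ k r x → k + r + suc x ≡ k + suc x + r
      swap = solve-∀
    k<u : k < toℕ (fromℕ< u<d)
    k<u = subst (k <_) (sym (FinP.toℕ-fromℕ< u<d)) (m<m+n k (s≤s z≤n))
    j≡start : j ≡ toℕ (fromℕ< k<u) + r
    j≡start = sym (trans (cong (_+ r) (FinP.toℕ-fromℕ< k<u)) k+r≡j)
    a≡length : suc a₁ ≡ c + (toℕ (fromℕ< u<d) ∸ toℕ (fromℕ< k<u))
    a≡length = sym (begin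
      c + (toℕ (fromℕ< u<d) ∸ toℕ (fromℕ< k<u))   ≡⟨ cong₂ (λ x y → c + (x ∸ y)) (FinP.toℕ-fromℕ< u<d) (FinP.toℕ-fromℕ< k<u) ⟩
      c + (u ∸ k)                                 ≡⟨ cong (c +_) (m+n∸m≡n k (suc (a₁ ∸ c))) ⟩
      c + suc (a₁ ∸ c)                            ≡⟨ +-suc c (a₁ ∸ c) ⟩
      suc (c + (a₁ ∸ c))                          ≡⟨ cong suc c+[a₁∸c]≡a₁ ⟩
      suc a₁                                      ∎)
      where open ≡-Reasoning

  classify-earlyRun : ∀ {s} (L : Layered n s) → let open Layered L in
                        j < r → 0 < a → a ≤ d → Σ (Param d c r) (λ p → CornerAgree d c r s (shape p))
  classify-earlyRun L@(layered j (suc a₁) _ _ _ _) j<r _ a≤d =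
    earlyRun (fromℕ< j<r) (fromℕ< a≤d) ,
    agree-exact L (earlyRun (fromℕ< j<r) (fromℕ< a≤d)) (sym (FinP.toℕ-fromℕ< j<r)) (cong suc (sym (FinP.toℕ-fromℕ< a≤d)))

  overlongEarlyRun⇒c≡0 : ∀ {s} (L : Layered n s) → Corner.LowerRowsInCornerColumns d c r s → let open Layered L in
                         j < r → d < a → j + a < n → c ≡ 0
  overlongEarlyRun⇒c≡0 {s} L@(layered j (suc a₁) _ _ _ bottom) lower j<r d<a j+a<n with c ℕ.≟ 0
  ... | yes c≡0 = c≡0
  ... | no c≢0  = contradiction (lower last d+r≤last last<n) (≤⇒≯ (subst (d + c ≤_) (sym s-last≡1+a₁) (m≤n⇒m≤1+n d+c≤a₁)))
    where
    j+1+a₁≤a₁+r : j + suc a₁ ≤ a₁ + r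
    j+1+a₁≤a₁+r = ≤-trans (≤-reflexive (+-suc j a₁)) (≤-trans (+-monoˡ-≤ a₁ j<r) (≤-reflexive (+-comm r a₁)))
    n≤a₁+r : n ≤ a₁ + r
    n≤a₁+r with a₁ + r ℕ.<? n
    ... | no a₁+r≮n  = ≮⇒≥ a₁+r≮n
    ... | yes a₁+r<n = contradiction (lower (a₁ + r) (+-monoˡ-≤ r (ℕ.s≤s⁻¹ d<a)) a₁+r<n) (≤⇒≯ (≤-reflexive (sym s≡d+c)))
      where
      s≡d+c : s (a₁ + r) ≡ d + c
      s≡d+c = +-cancelʳ-≡ r _ _ (+-cancelʳ-≡ (suc a₁) _ _ (begin
        s (a₁ + r) + r + suc a₁          ≡⟨ rearrange (s (a₁ + r)) a₁ r ⟩
        s (a₁ + r) + suc (a₁ + r)        ≡⟨ bottom (a₁ + r) j+1+a₁≤a₁+r a₁+r<n ⟩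
        d + c + r + suc a₁               ∎))
        where
        open ≡-Reasoning
        rearrange : ∀ x a r → x + r + suc a ≡ x + suc (a + r)
        rearrange = solve-∀
    d+c≤a₁ : d + c ≤ a₁
    d+c≤a₁ = +-cancelʳ-≤ r (d + c) a₁ n≤a₁+r
    last = n ∸ 1
    1+last≡n : suc last ≡ n
    1+last≡n = trans (+-comm 1 last) (m∸n+n≡m (≤-trans (s≤s z≤n) j+a<n))
    last<n : last < n
    last<n = subst (last <_) 1+last≡n ≤-refl
    d+r≤last : d + r ≤ last
    d+r≤last = ℕ.s≤s⁻¹ (subst (suc (d + r) ≤_) (sym 1+last≡n)
                 (subst (_≤ n) (shift d r) (+-monoˡ-≤ r (+-monoʳ-≤ d (n≢0⇒n>0 c≢0)))))
      where
      shift : ∀ d r → d + 1 + r ≡ suc (d + r)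
      shift = solve-∀
    s-last≡1+a₁ : s last ≡ suc a₁
    s-last≡1+a₁ = +-cancelʳ-≡ n (s last) (suc a₁) (trans (cong (s last +_) (sym 1+last≡n))
                    (trans (bottom last (ℕ.s≤s⁻¹ (subst (suc (j + suc a₁) ≤_) (sym 1+last≡n) j+a<n)) last<n) (+-comm n (suc a₁))))

-- Without empty columns, an overlong early run has the same corner as the early run of length d
-- ending at the same place.
classify-overlongEarlyRun : ∀ d r {s} (L : Layered (d + 0 + r) s) → let open Layered L in
  j < r → d < a → j + a < d + 0 + r → Σ (Param d 0 r) (λ p → CornerAgree d 0 r s (Extension.shape d 0 r p))
classify-overlongEarlyRun zero r _ _ _ _ = reversal , λ _ _ → inj₂ (z≤n , z≤n)
classify-overlongEarlyRun d@(suc d₁) r {s} L@(layered j a _ top middle bottom) j<r d<a j+a<n = p , agree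
  where
  open Extension d 0 r
  j′ = j + (a ∸ d)
  j′+d≡j+a : j′ + d ≡ j + a
  j′+d≡j+a = trans (+-assoc j _ d) (cong (j +_) (m∸n+n≡m (<⇒≤ d<a)))
  j′<r : j′ < r
  j′<r = +-cancelʳ-< d j′ r (subst (_< r + d) (sym j′+d≡j+a) (subst (j + a <_) (trans (cong (_+ r) (+-identityʳ d)) (+-comm d r)) j+a<n))
  j<j′ : j < j′
  j<j′ = subst (_< j′) (+-identityʳ j) (+-monoʳ-< j (m<n⇒0<n∸m d<a))
  p : Param d 0 r
  p = earlyRun (fromℕ< j′<r) (fromℕ< (n<1+n d₁))
  P = shape-Layered p
  start≡j′ : runStart p ≡ j′
  start≡j′ = FinP.toℕ-fromℕ< j′<r
  length≡d : runLength p ≡ d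
  length≡d = cong suc (FinP.toℕ-fromℕ< (n<1+n d₁))
  end≡j+a : runStart p + runLength p ≡ j + a
  end≡j+a = trans (cong₂ _+_ start≡j′ length≡d) j′+d≡j+a
  high : ∀ {x} → d ≤ x → d + 0 ≤ x
  high {x} = subst (_≤ x) (sym (+-identityʳ d))
  agree : CornerAgree d 0 r s (shape p)
  agree i i<d+r with i ℕ.<? j
  ... | yes i<j = inj₁ (+-cancelʳ-≡ (suc i) _ _ (trans (top i i<j) (sym (Layered.top P i (subst (i <_) (sym start≡j′) (<-trans i<j j<j′))))))
  ... | no i≮j with i ℕ.<? j′
  ...   | yes i<j′ = inj₂ (high (+-cancelʳ-≤ (suc i) d (s i) s-high) , high (+-cancelʳ-≤ (suc i) d (shape p i) shape-high))
    where
    s-high : d + suc i ≤ s i + suc i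
    s-high = subst (d + suc i ≤_)
               (sym (trans (middle i (≮⇒≥ i≮j) (<-trans i<j′ (subst (j′ <_) j′+d≡j+a (m<m+n j′ (s≤s z≤n))))) (sym j′+d≡j+a)))
               (subst (_≤ j′ + d) (+-comm (suc i) d) (+-monoˡ-≤ d i<j′))
    shape-high : d + suc i ≤ shape p i + suc i
    shape-high = subst (d + suc i ≤_) (sym (Layered.top P i (subst (i <_) (sym start≡j′) i<j′)))
                   (subst (d + suc i ≤_) (cong (_+ r) (sym (+-identityʳ d))) (+-monoʳ-≤ d (<-trans i<j′ j′<r)))
  ...   | no i≮j′ with i ℕ.<? j + a
  ...     | yes i<j+a = inj₁ (+-cancelʳ-≡ (suc i) _ _ (trans (middle i (≮⇒≥ i≮j) i<j+a)
                          (sym (trans (Layered.middle P i (subst (_≤ i) (sym start≡j′) (≮⇒≥ i≮j′)) (subst (i <_) (sym end≡j+a) i<j+a))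
                                      end≡j+a))))
  ...     | no i≮j+a  = inj₂ (high (≤-trans (<⇒≤ d<a) (LayeredProperties.bottom-≥a L i (≮⇒≥ i≮j+a) i<n)) ,
                              high (subst (_≤ shape p i) length≡d
                                      (LayeredProperties.bottom-≥a P i (subst (_≤ i) (sym end≡j+a) (≮⇒≥ i≮j+a)) i<n)))
    where
    i<n : i < d + 0 + r
    i<n = <-≤-trans i<d+r (+-monoˡ-≤ r (m≤m+n d 0))

classify : ∀ d c r {s} → Layered (d + c + r) s → Corner.LowerRowsInCornerColumns d c r s →
           Σ (Param d c r) (λ p → CornerAgree d c r s (Extension.shape d c r p))
classify d c r {s} L@(layered j zero _ _ _ _) _ =
  reversal , agree-reversal d c r λ i i<d+r → LayeredProperties.no-middle⇒top L (inj₁ refl) i (<-≤-trans i<d+r (d+r≤n d c r))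
classify d c r {s} L@(layered j (suc a₁) j+a≤n top middle bottom) lower with j + suc a₁ ℕ.≟ d + c + r
... | yes j+a≡n =
  reversal , agree-reversal d c r λ i i<d+r → LayeredProperties.no-middle⇒top L (inj₂ j+a≡n) i (<-≤-trans i<d+r (d+r≤n d c r))
... | no j+a≢n with d + r ℕ.≤? j
...   | yes d+r≤j = reversal , agree-reversal d c r λ i i<d+r → top i (<-≤-trans i<d+r d+r≤j)
...   | no d+r≰j with r ℕ.≤? j
...     | yes r≤j = classify-lateRun d c r L r≤j (≰⇒> d+r≰j) (s≤s z≤n) (≤∧≢⇒< j+a≤n j+a≢n)
...     | no r≰j with suc a₁ ℕ.≤? d
...       | yes a≤d = classify-earlyRun d c r L (≰⇒> r≰j) (s≤s z≤n) a≤d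
...       | no a≰d with overlongEarlyRun⇒c≡0 d c r L lower (≰⇒> r≰j) (≰⇒> a≰d) (≤∧≢⇒< j+a≤n j+a≢n)
...         | refl = classify-overlongEarlyRun d r L (≰⇒> r≰j) (≰⇒> a≰d) (≤∧≢⇒< j+a≤n j+a≢n)

-- Decoding the parameter from its corner

firstBelow : ℕ → (ℕ → Bool) → Maybe ℕ
firstBelow zero    f = nothing
firstBelow (suc m) f = if f 0 then just 0 else Maybe.map suc (firstBelow m (λ i → f (suc i)))

firstBelow-nothing : ∀ m f → (∀ u → u < m → f u ≡ false) → firstBelow m f ≡ nothing
firstBelow-nothing zero    f _     = refl
firstBelow-nothing (suc m) f miss rewrite miss 0 (s≤s z≤n) =
  cong (Maybe.map suc) (firstBelow-nothing m _ (λ u u<m → miss (suc u) (s≤s u<m)))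

firstBelow-just : ∀ m f t → t < m → f t ≡ true → (∀ u → u < t → f u ≡ false) → firstBelow m f ≡ just t
firstBelow-just (suc m) f zero    _         hit _    rewrite hit = refl
firstBelow-just (suc m) f (suc t) (s≤s t<m) hit miss rewrite miss 0 (s≤s z≤n) =
  cong (Maybe.map suc) (firstBelow-just m _ t t<m hit (λ u u<t → miss (suc u) (s≤s u<t)))

toFin : ∀ m → ℕ → Maybe (Fin m)
toFin zero    _       = nothing
toFin (suc m) zero    = just F.zero
toFin (suc m) (suc i) = Maybe.map F.suc (toFin m i)

toFin-toℕ : ∀ {m} (x : Fin m) → toFin m (toℕ x) ≡ just x
toFin-toℕ F.zero    = refl
toFin-toℕ (F.suc x) rewrite toFin-toℕ x = refl

toFin-≥ : ∀ m i → m ≤ i → toFin m i ≡ nothing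
toFin-≥ zero    i       _         = refl
toFin-≥ (suc m) (suc i) (s≤s m≤i) rewrite toFin-≥ m i m≤i = refl

toFin-fromℕ< : ∀ m i → (i<m : i < m) → toFin m i ≡ just (fromℕ< i<m)
toFin-fromℕ< m i i<m = trans (cong (toFin m) (sym (FinP.toℕ-fromℕ< i<m))) (toFin-toℕ (fromℕ< i<m))

-- The parameter is read off the corner: the first of the r top rows with a dot is the start of
-- an early run and its column the length; otherwise the first break of the antidiagonal below
-- them is the start of the run and the column of its dot the length.
module Decode (d c r : ℕ) where

  entryℕ : Matrix (d + r) (d + c) → ℕ → ℕ → Bool
  entryℕ ρ i v with i ℕ.<? d + r | v ℕ.<? d + c
  ... | yes i<d+r | yes v<d+c = lookup (lookup ρ (fromℕ< i<d+r)) (fromℕ< v<d+c)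
  ... | _         | _         = false

  dotColumn : Matrix (d + r) (d + c) → ℕ → Maybe ℕ
  dotColumn ρ i = firstBelow (d + c) (entryℕ ρ i)

  firstDottedTopRow : Matrix (d + r) (d + c) → Maybe ℕ
  firstDottedTopRow ρ = firstBelow r (λ i → is-just (dotColumn ρ i))

  antidiagonalBreak : Matrix (d + r) (d + c) → Maybe ℕ
  antidiagonalBreak ρ = firstBelow d (λ t → not (entryℕ ρ (r + t) (d + c ∸ suc t)))

  earlyRunParam : Maybe (Fin r) → Maybe (Fin d) → Param d c r
  earlyRunParam (just j) (just y) = earlyRun j y
  earlyRunParam _        _        = reversal

  longRunParam′ : (u : Fin d) → Maybe (Fin (toℕ u)) → Param d c r
  longRunParam′ u (just w) = longRun u w
  longRunParam′ u nothing  = reversal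

  longRunParam : Maybe (Fin d) → ℕ → Param d c r
  longRunParam (just u) w = longRunParam′ u (toFin (toℕ u) w)
  longRunParam nothing  w = reversal

  lateRunParam′ : Fin d → ℕ → Maybe (Fin c) → Param d c r
  lateRunParam′ k v (just y) = shortRun k y
  lateRunParam′ k v nothing  = longRunParam (toFin d (toℕ k + suc (v ∸ c))) (toℕ k)

  lateRunParam : Maybe (Fin d) → ℕ → Param d c r
  lateRunParam (just k) v = lateRunParam′ k v (toFin c v)
  lateRunParam nothing  v = reversal

  decodeBreak : ℕ → Maybe ℕ → Param d c r
  decodeBreak k (just v) = lateRunParam (toFin d k) v
  decodeBreak k nothing  = reversal

  decodeBelow : Matrix (d + r) (d + c) → Maybe ℕ → Param d c r
  decodeBelow ρ (just k) = decodeBreak k (dotColumn ρ (r + k))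
  decodeBelow ρ nothing  = reversal

  decodeTopRow : ℕ → Maybe ℕ → Param d c r
  decodeTopRow j (just v) = earlyRunParam (toFin r j) (toFin d v)
  decodeTopRow j nothing  = reversal

  decodeTop : Matrix (d + r) (d + c) → Maybe ℕ → Param d c r
  decodeTop ρ (just j) = decodeTopRow j (dotColumn ρ j)
  decodeTop ρ nothing  = decodeBelow ρ (antidiagonalBreak ρ)

  decode : Matrix (d + r) (d + c) → Param d c r
  decode ρ = decodeTop ρ (firstDottedTopRow ρ)

module DecodeCorrect (d c r : ℕ) where
  open Extension d c r
  open Decode d c r
  open Corner d c r

  entryℕ-fromℕ< : ∀ ρ {i v} (i<d+r : i < d + r) (v<d+c : v < d + c) →
                  entryℕ ρ i v ≡ lookup (lookup ρ (fromℕ< i<d+r)) (fromℕ< v<d+c)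
  entryℕ-fromℕ< ρ {i} {v} i<d+r v<d+c with i ℕ.<? d + r | v ℕ.<? d + c
  ... | yes _ | yes _ = cong₂ (λ x y → lookup (lookup ρ x) y) (FinP.fromℕ<-cong _ _ refl _ _) (FinP.fromℕ<-cong _ _ refl _ _)
  ... | no i≮d+r | _  = contradiction i<d+r i≮d+r
  ... | yes _ | no v≮d+c = contradiction v<d+c v≮d+c

  module _ (σ : Vec (Fin n) n) (σ-perm : IsPerm σ) where

    entryℕ-corner : ∀ {i v} → i < d + r → v < d + c → entryℕ (corner σ) i v ≡ ⌊ at σ i ℕ.≟ v ⌋
    entryℕ-corner {i} {v} i<d+r v<d+c = begin
      entryℕ (corner σ) i v                                              ≡⟨ entryℕ-fromℕ< (corner σ) i<d+r v<d+c ⟩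
      lookup (lookup (corner σ) (fromℕ< i<d+r)) (fromℕ< v<d+c)           ≡⟨ cong (λ M → lookup (lookup M (fromℕ< i<d+r)) (fromℕ< v<d+c))
                                                                              (corner-tabulate σ σ-perm) ⟩
      lookup (lookup (tabulate λ i → tabulate λ j → dot i j) (fromℕ< i<d+r)) (fromℕ< v<d+c)
                                                                         ≡⟨ cong (λ row → lookup row (fromℕ< v<d+c))
                                                                              (VecP.lookup∘tabulate (λ i → tabulate (dot i)) (fromℕ< i<d+r)) ⟩
      lookup (tabulate (dot (fromℕ< i<d+r))) (fromℕ< v<d+c)              ≡⟨ VecP.lookup∘tabulate (dot (fromℕ< i<d+r)) (fromℕ< v<d+c) ⟩
      dot (fromℕ< i<d+r) (fromℕ< v<d+c)                                  ≡⟨ ⌊≟⌋-toℕ _ _ ⟩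
      ⌊ toℕ (lookup σ (rowEmbed (fromℕ< i<d+r))) ℕ.≟ toℕ (colEmbed (fromℕ< v<d+c)) ⌋
                                                                         ≡⟨ cong₂ (λ x y → ⌊ x ℕ.≟ y ⌋)
                                                                              (trans (toℕ-σ-rowEmbed σ σ-perm _) (cong (at σ) (FinP.toℕ-fromℕ< i<d+r)))
                                                                              (trans (FinP.toℕ-inject≤ _ _) (FinP.toℕ-fromℕ< v<d+c)) ⟩
      ⌊ at σ i ℕ.≟ v ⌋                                                   ∎
      where
      open ≡-Reasoning
      dot : Fin (d + r) → Fin (d + c) → Bool
      dot i j = ⌊ lookup σ (rowEmbed i) F.≟ colEmbed j ⌋

    dotColumn-outside : ∀ i → i < d + r → d + c ≤ at σ i → dotColumn (corner σ) i ≡ nothing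
    dotColumn-outside i i<d+r d+c≤σi = firstBelow-nothing (d + c) _ λ v v<d+c →
      trans (entryℕ-corner i<d+r v<d+c) (⌊⌋≡false (at σ i ℕ.≟ v) (λ σi≡v → <⇒≱ v<d+c (subst (d + c ≤_) σi≡v d+c≤σi)))

    dotColumn-inside : ∀ i → i < d + r → at σ i < d + c → dotColumn (corner σ) i ≡ just (at σ i)
    dotColumn-inside i i<d+r σi<d+c = firstBelow-just (d + c) _ (at σ i) σi<d+c
      (trans (entryℕ-corner i<d+r σi<d+c) (⌊⌋≡true (at σ i ℕ.≟ at σ i) refl))
      (λ v v<σi → trans (entryℕ-corner i<d+r (<-trans v<σi σi<d+c)) (⌊⌋≡false (at σ i ℕ.≟ v) (λ σi≡v → <-irrefl (sym σi≡v) v<σi)))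

  extension-IsPerm : ∀ p → IsPerm (extension p)
  extension-IsPerm p = Layered⇒IsPerm (extension p) (extension-Layered p)

  private
    top-value-outside : ∀ x i → x + suc i ≡ n → i < r → d + c ≤ x
    top-value-outside x i x+1+i≡n i<r = +-cancelʳ-≤ r (d + c) x (subst (_≤ x + r) x+1+i≡n (+-monoʳ-≤ x i<r))

    top-value-antidiagonal : ∀ x t → x + suc (r + t) ≡ n → x ≡ d + c ∸ suc t
    top-value-antidiagonal x t x+1+r+t≡n = sym (trans (cong (_∸ suc t) (sym x+1+t≡d+c)) (m+n∸n≡m x (suc t)))
      where
      swap : ∀ x r t → x + suc (r + t) ≡ x + suc t + r
      swap = solve-∀
      x+1+t≡d+c : x + suc t ≡ d + c
      x+1+t≡d+c = +-cancelʳ-≡ r _ _ (trans (sym (swap x r t)) x+1+r+t≡n)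

    middle-value : ∀ x j y → x + suc j ≡ j + suc y → x ≡ y
    middle-value x j y e = +-cancelʳ-≡ (suc j) x y (trans e (x+[1+y]≡y+[1+x] j y))

    antidiagonal<d+c : ∀ t → t < d → d + c ∸ suc t < d + c
    antidiagonal<d+c t t<d = ∸-monoʳ-< {o = 0} (s≤s z≤n) (≤-trans t<d (m≤m+n d c))

    r+t<d+r : ∀ t → t < d → r + t < d + r
    r+t<d+r t t<d = subst (r + t <_) (+-comm r d) (+-monoʳ-< r t<d)

  module OnExtension (p : Param d c r) where
    σ = extension p
    σ-perm = extension-IsPerm p
    s = at σ
    ρ = corner σ
    L = extension-Layered p

    noDottedTopRow : r ≤ runStart p → firstDottedTopRow ρ ≡ nothing
    noDottedTopRow r≤j = firstBelow-nothing r _ λ i i<r → cong is-just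
      (dotColumn-outside σ σ-perm i (<-≤-trans i<r (m≤n+m r d))
         (top-value-outside (s i) i (Layered.top L i (<-≤-trans i<r r≤j)) i<r))

    antidiagonal : ∀ t → r + t < runStart p → t < d → entryℕ ρ (r + t) (d + c ∸ suc t) ≡ true
    antidiagonal t r+t<j t<d = trans (entryℕ-corner σ σ-perm (r+t<d+r t t<d) (antidiagonal<d+c t t<d))
      (⌊⌋≡true (s (r + t) ℕ.≟ d + c ∸ suc t) (top-value-antidiagonal (s (r + t)) t (Layered.top L (r + t) r+t<j)))

  decode-extension-reversal : decode (corner (extension reversal)) ≡ reversal
  decode-extension-reversal = begin
    decode ρ                                  ≡⟨ cong (decodeTop ρ) (noDottedTopRow (m≤n+m r (d + c))) ⟩
    decodeBelow ρ (antidiagonalBreak ρ)       ≡⟨ cong (decodeBelow ρ) (firstBelow-nothing d _ λ t t<d →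
                                                   cong not (antidiagonal t (<-≤-trans (r+t<d+r t t<d) (d+r≤n d c r)) t<d)) ⟩
    reversal                                  ∎
    where
    open OnExtension reversal
    open ≡-Reasoning

  decode-extension-shortRun : ∀ k y → decode (corner (extension (shortRun k y))) ≡ shortRun k y
  decode-extension-shortRun k y = begin
    decode ρ                                  ≡⟨ cong (decodeTop ρ) (noDottedTopRow (m≤n+m r (toℕ k))) ⟩
    decodeBelow ρ (antidiagonalBreak ρ)       ≡⟨ cong (decodeBelow ρ) break≡k ⟩
    decodeBreak (toℕ k) (dotColumn ρ (r + toℕ k)) ≡⟨ cong (decodeBreak (toℕ k)) dot≡y ⟩
    lateRunParam (toFin d (toℕ k)) (toℕ y)  ≡⟨ cong (λ x → lateRunParam x (toℕ y)) (toFin-toℕ k) ⟩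
    lateRunParam′ k (toℕ y) (toFin c (toℕ y)) ≡⟨ cong (lateRunParam′ k (toℕ y)) (toFin-toℕ y) ⟩
    shortRun k y                              ∎
    where
    open OnExtension (shortRun k y)
    open ≡-Reasoning
    k<d = FinP.toℕ<n k
    s≡y : s (r + toℕ k) ≡ toℕ y
    s≡y = trans (cong s (+-comm r (toℕ k))) (middle-value (s (toℕ k + r)) (toℕ k + r) (toℕ y)
            (Layered.middle L (toℕ k + r) ≤-refl (m<m+n (toℕ k + r) (s≤s z≤n))))
    y<antidiagonal : toℕ y < d + c ∸ suc (toℕ k)
    y<antidiagonal = <-≤-trans (FinP.toℕ<n y) (m+n≤o⇒m≤o∸n c (subst (c + suc (toℕ k) ≤_) (+-comm c d) (+-monoʳ-≤ c k<d)))
    break≡k : antidiagonalBreak ρ ≡ just (toℕ k)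
    break≡k = firstBelow-just d _ (toℕ k) k<d
      (cong not (trans (entryℕ-corner σ (σ-perm) (r+t<d+r _ k<d) (antidiagonal<d+c _ k<d))
                       (⌊⌋≡false (s (r + toℕ k) ℕ.≟ _) (λ s≡ → <-irrefl (trans (sym s≡y) s≡) y<antidiagonal))))
      (λ t t<k → cong not (antidiagonal t (subst (r + t <_) (+-comm r (toℕ k)) (+-monoʳ-< r t<k)) (<-trans t<k k<d)))
    dot≡y : dotColumn ρ (r + toℕ k) ≡ just (toℕ y)
    dot≡y = trans (dotColumn-inside σ (σ-perm) (r + toℕ k) (r+t<d+r _ k<d)
                    (subst (_< d + c) (sym s≡y) (<-≤-trans y<antidiagonal (m∸n≤m (d + c) (suc (toℕ k))))))
                  (cong just s≡y)

  decode-extension-longRun : ∀ u w → decode (corner (extension (longRun u w))) ≡ longRun u w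
  decode-extension-longRun u w = begin
    decode ρ                                      ≡⟨ cong (decodeTop ρ) (noDottedTopRow (m≤n+m r (toℕ w))) ⟩
    decodeBelow ρ (antidiagonalBreak ρ)           ≡⟨ cong (decodeBelow ρ) break≡w ⟩
    decodeBreak (toℕ w) (dotColumn ρ (r + toℕ w)) ≡⟨ cong (decodeBreak (toℕ w)) dot≡v ⟩
    lateRunParam (toFin d (toℕ w)) v            ≡⟨ cong (λ x → lateRunParam x v) (toFin-fromℕ< d (toℕ w) w<d) ⟩
    lateRunParam′ (fromℕ< w<d) v (toFin c v)    ≡⟨ cong (lateRunParam′ (fromℕ< w<d) v) (toFin-≥ c v (m≤m+n c _)) ⟩
    longRunParam (toFin d (toℕ (fromℕ< w<d) + suc (v ∸ c))) (toℕ (fromℕ< w<d))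
                                                  ≡⟨ cong₂ longRunParam (cong (toFin d) u≡) (FinP.toℕ-fromℕ< w<d) ⟩
    longRunParam (toFin d (toℕ u)) (toℕ w)        ≡⟨ cong (λ x → longRunParam x (toℕ w)) (toFin-toℕ u) ⟩
    longRunParam′ u (toFin (toℕ u) (toℕ w))       ≡⟨ cong (longRunParam′ u) (toFin-toℕ w) ⟩
    longRun u w                                   ∎
    where
    open OnExtension (longRun u w)
    open ≡-Reasoning
    w<u : toℕ w < toℕ u
    w<u = FinP.toℕ<n w
    w<d : toℕ w < d
    w<d = <-trans w<u (FinP.toℕ<n u)
    v = c + (toℕ u ∸ suc (toℕ w))
    length≡1+v : c + (toℕ u ∸ toℕ w) ≡ suc v
    length≡1+v = trans (cong (c +_) (+-∸-assoc 1 w<u)) (+-suc c _)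
    u≡ : toℕ (fromℕ< w<d) + suc (v ∸ c) ≡ toℕ u
    u≡ = trans (cong₂ (λ x y → x + suc y) (FinP.toℕ-fromℕ< w<d) (m+n∸m≡n c _)) (trans (+-suc (toℕ w) _) (m+[n∸m]≡n w<u))
    s≡v : s (r + toℕ w) ≡ v
    s≡v = trans (cong s (+-comm r (toℕ w))) (middle-value (s (toℕ w + r)) (toℕ w + r) v
            (trans (Layered.middle L (toℕ w + r) ≤-refl (subst (toℕ w + r <_) (cong (toℕ w + r +_) (sym length≡1+v))
                                                                (m<m+n (toℕ w + r) (s≤s z≤n))))
                   (cong (toℕ w + r +_) length≡1+v)))
    v+1+w≡c+u : v + suc (toℕ w) ≡ c + toℕ u
    v+1+w≡c+u = trans (+-assoc c _ (suc (toℕ w))) (cong (c +_) (m∸n+n≡m w<u))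
    v<antidiagonal : v < d + c ∸ suc (toℕ w)
    v<antidiagonal = m+n≤o⇒m≤o∸n (suc v) (subst (_≤ d + c) (sym (cong suc v+1+w≡c+u))
                       (subst (suc (c + toℕ u) ≤_) (+-comm c d) (+-monoʳ-< c (FinP.toℕ<n u))))
    break≡w : antidiagonalBreak ρ ≡ just (toℕ w)
    break≡w = firstBelow-just d _ (toℕ w) w<d
      (cong not (trans (entryℕ-corner σ (σ-perm) (r+t<d+r _ w<d) (antidiagonal<d+c _ w<d))
                       (⌊⌋≡false (s (r + toℕ w) ℕ.≟ _) (λ s≡ → <-irrefl (trans (sym s≡v) s≡) v<antidiagonal))))
      (λ t t<w → cong not (antidiagonal t (subst (r + t <_) (+-comm r (toℕ w)) (+-monoʳ-< r t<w)) (<-trans t<w w<d)))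
    dot≡v : dotColumn ρ (r + toℕ w) ≡ just v
    dot≡v = trans (dotColumn-inside σ (σ-perm) (r + toℕ w) (r+t<d+r _ w<d)
                    (subst (_< d + c) (sym s≡v) (<-≤-trans v<antidiagonal (m∸n≤m (d + c) (suc (toℕ w))))))
                  (cong just s≡v)

  decode-extension-earlyRun : ∀ j y → decode (corner (extension (earlyRun j y))) ≡ earlyRun j y
  decode-extension-earlyRun j y = begin
    decode ρ                                     ≡⟨ cong (decodeTop ρ) first≡j ⟩
    decodeTopRow (toℕ j) (dotColumn ρ (toℕ j))   ≡⟨ cong (decodeTopRow (toℕ j)) dot≡y ⟩
    earlyRunParam (toFin r (toℕ j)) (toFin d (toℕ y)) ≡⟨ cong₂ earlyRunParam (toFin-toℕ j) (toFin-toℕ y) ⟩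
    earlyRun j y                                 ∎
    where
    open OnExtension (earlyRun j y)
    open ≡-Reasoning
    j<r = FinP.toℕ<n j
    j<d+r : toℕ j < d + r
    j<d+r = <-≤-trans j<r (m≤n+m r d)
    s≡y : s (toℕ j) ≡ toℕ y
    s≡y = middle-value (s (toℕ j)) (toℕ j) (toℕ y) (Layered.middle L (toℕ j) ≤-refl (m<m+n (toℕ j) (s≤s z≤n)))
    dot≡y : dotColumn ρ (toℕ j) ≡ just (toℕ y)
    dot≡y = trans (dotColumn-inside σ (σ-perm) (toℕ j) j<d+r
                    (subst (_< d + c) (sym s≡y) (<-≤-trans (FinP.toℕ<n y) (m≤m+n d c))))
                  (cong just s≡y)
    first≡j : firstDottedTopRow ρ ≡ just (toℕ j)
    first≡j = firstBelow-just r _ (toℕ j) j<r (cong is-just dot≡y)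
      (λ i i<j → cong is-just (dotColumn-outside σ (σ-perm) i (<-trans i<j j<d+r)
                                (top-value-outside (s i) i (Layered.top L i i<j) (<-trans i<j j<r))))

  decode-extension : ∀ p → decode (corner (extension p)) ≡ p
  decode-extension reversal       = decode-extension-reversal
  decode-extension (shortRun k y) = decode-extension-shortRun k y
  decode-extension (longRun u w)  = decode-extension-longRun u w
  decode-extension (earlyRun j y) = decode-extension-earlyRun j y

-- The bijections

S-≡ : ∀ {d c r τ ρ ρ′} {t : True (InSτ? d c r τ ρ)} {t′ : True (InSτ? d c r τ ρ′)} →
      ρ ≡ ρ′ → _≡_ {A = S d c r τ} (ρ , t) (ρ′ , t′)
S-≡ {ρ = ρ} {t = t} {t′} refl = cong (ρ ,_) (T-irrelevant t t′)

module ParamBijection (d c r : ℕ) where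
  open Extension d c r
  open Corner d c r
  open Decode d c r
  open DecodeCorrect d c r

  Layered⇒LowerRowsInCornerColumns : ∀ {s} (L : Layered n s) → let open Layered L in
    a ≤ d + c → r ≤ j ⊎ a ≤ d → LowerRowsInCornerColumns s
  Layered⇒LowerRowsInCornerColumns {s} L@(layered j a _ top _ bottom) a≤d+c r≤j⊎a≤d i d+r≤i i<n with i ℕ.<? j
  ... | yes i<j = +-cancelʳ-< r (s i) (d + c) (subst (s i + r <_) (top i i<j) (+-monoʳ-< (s i) (s≤s (≤-trans (m≤n+m r d) d+r≤i))))
  ... | no i≮j with i ℕ.<? j + a
  ...   | yes i<j+a = <-≤-trans (LayeredProperties.middle-low L i (≮⇒≥ i≮j) i<j+a) a≤d+c
  ...   | no i≮j+a with r≤j⊎a≤d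
  ...     | inj₁ r≤j = +-cancelʳ-< r (s i) (d + c)
                         (≤-<-trans (+-monoʳ-≤ (s i) r≤j) (LayeredProperties.bottom-below-top L i (≮⇒≥ i≮j+a) i<n))
  ...     | inj₂ a≤d = +-cancelʳ-≤ (d + r) (suc (s i)) (d + c) (subst₂ _≤_ (shift (s i) d r) (rotate d c r)
                         (≤-trans (+-monoʳ-≤ (s i) (s≤s d+r≤i)) (subst (_≤ n + d) (sym (bottom i (≮⇒≥ i≮j+a) i<n)) (+-monoʳ-≤ n a≤d))))
    where
    shift : ∀ x d r → x + suc (d + r) ≡ suc x + (d + r)
    shift = solve-∀
    rotate : ∀ d c r → d + c + r + d ≡ d + c + (d + r)
    rotate = solve-∀

  extension-LowerRowsInCornerColumns : ∀ p → LowerRowsInCornerColumns (at (extension p))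
  extension-LowerRowsInCornerColumns p = Layered⇒LowerRowsInCornerColumns (extension-Layered p) (length≤d+c p) (start≥r⊎length≤d p)
    where
    length≤d+c : ∀ p → runLength p ≤ d + c
    length≤d+c reversal       = z≤n
    length≤d+c (shortRun k y) = ≤-trans (FinP.toℕ<n y) (m≤n+m c d)
    length≤d+c (longRun u w)  = subst (c + (toℕ u ∸ toℕ w) ≤_) (+-comm c d)
                                  (+-monoʳ-≤ c (≤-trans (m∸n≤m (toℕ u) (toℕ w)) (<⇒≤ (FinP.toℕ<n u))))
    length≤d+c (earlyRun j y) = ≤-trans (FinP.toℕ<n y) (m≤m+n d c)
    start≥r⊎length≤d : ∀ p → r ≤ runStart p ⊎ runLength p ≤ d
    start≥r⊎length≤d reversal       = inj₁ (m≤n+m r (d + c))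
    start≥r⊎length≤d (shortRun k y) = inj₁ (m≤n+m r (toℕ k))
    start≥r⊎length≤d (longRun u w)  = inj₁ (m≤n+m r (toℕ w))
    start≥r⊎length≤d (earlyRun j y) = inj₂ (FinP.toℕ<n y)

  corner-extension-InSτ₁ : ∀ p → InSτ d c r τ₁ (corner (extension p))
  corner-extension-InSτ₁ p =
    LowerRowsInCornerColumns⇒IsInS (extension p) (extension-IsPerm p) (extension-LowerRowsInCornerColumns p) ,
    extension p , extension-IsPerm p , refl , Layered⇒Avoids (extension p) (extension-Layered p)

  CornerAgree⇒corner≡ : ∀ σ σ′ → IsPerm σ → IsPerm σ′ → CornerAgree d c r (at σ) (at σ′) → corner σ ≡ corner σ′
  CornerAgree⇒corner≡ σ σ′ σ-perm σ′-perm agree = begin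
    corner σ                                                     ≡⟨ corner-tabulate σ σ-perm ⟩
    tabulate (λ i → tabulate λ j → ⌊ lookup σ (rowEmbed i) F.≟ colEmbed j ⌋)   ≡⟨ VecP.tabulate-cong (λ i → VecP.tabulate-cong (dot≡ i)) ⟩
    tabulate (λ i → tabulate λ j → ⌊ lookup σ′ (rowEmbed i) F.≟ colEmbed j ⌋)  ≡⟨ sym (corner-tabulate σ′ σ′-perm) ⟩
    corner σ′                                                    ∎
    where
    open ≡-Reasoning
    offCorner : ∀ {τ} (τ-perm : IsPerm τ) i j → d + c ≤ at τ (toℕ i) → ⌊ lookup τ (rowEmbed i) F.≟ colEmbed j ⌋ ≡ false
    offCorner {τ} τ-perm i j d+c≤τi = ⌊⌋≡false (lookup τ (rowEmbed i) F.≟ colEmbed j) λ τi≡j →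
      <⇒≱ (FinP.toℕ<n j) (subst (d + c ≤_) (trans (sym (toℕ-σ-rowEmbed τ τ-perm i)) (trans (cong toℕ τi≡j) (FinP.toℕ-inject≤ j _))) d+c≤τi)
    dot≡ : ∀ i j → ⌊ lookup σ (rowEmbed i) F.≟ colEmbed j ⌋ ≡ ⌊ lookup σ′ (rowEmbed i) F.≟ colEmbed j ⌋
    dot≡ i j with agree (toℕ i) (FinP.toℕ<n i)
    ... | inj₁ σi≡σ′i = cong (λ x → ⌊ x F.≟ colEmbed j ⌋) (FinP.toℕ-injective
                          (trans (toℕ-σ-rowEmbed σ σ-perm i) (trans σi≡σ′i (sym (toℕ-σ-rowEmbed σ′ σ′-perm i)))))
    ... | inj₂ (high , high′) = trans (offCorner σ-perm i j high) (sym (offCorner σ′-perm i j high′))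

  InSτ₁⇒corner-extension : ∀ ρ → InSτ d c r τ₁ ρ → Σ (Param d c r) (λ p → ρ ≡ corner (extension p))
  InSτ₁⇒corner-extension ρ (ρ∈S , σ , σ-perm , σ-extends , σ-avoids) with
    classify d c r (Avoids⇒Layered σ σ-perm σ-avoids)
      (IsInS⇒LowerRowsInCornerColumns σ σ-perm (subst (IsInS d c r) (sym σ-extends) ρ∈S))
  ... | p , agree = p , trans (sym σ-extends) (CornerAgree⇒corner≡ σ (extension p) σ-perm (extension-IsPerm p)
                                                 λ i i<d+r → agree-extension (agree i i<d+r) (at-extension p i (<-≤-trans i<d+r (d+r≤n d c r))))
    where
    agree-extension : ∀ {x y y′} → x ≡ y ⊎ (d + c ≤ x × d + c ≤ y) → y′ ≡ y → x ≡ y′ ⊎ (d + c ≤ x × d + c ≤ y′)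
    agree-extension (inj₁ x≡y)        refl = inj₁ x≡y
    agree-extension (inj₂ (hx , hy))  refl = inj₂ (hx , hy)

  fromParam : Param d c r → S d c r τ₁
  fromParam p = corner (extension p) , fromWitness {a? = InSτ? d c r τ₁ (corner (extension p))} (corner-extension-InSτ₁ p)

  toParam : S d c r τ₁ → Param d c r
  toParam (ρ , _) = decode ρ

  fromParam-toParam : ∀ x → fromParam (toParam x) ≡ x
  fromParam-toParam (ρ , t) = via (InSτ₁⇒corner-extension ρ (toWitness {a? = InSτ? d c r τ₁ ρ} t))
    where
    via : Σ (Param d c r) (λ p → ρ ≡ corner (extension p)) → fromParam (toParam (ρ , t)) ≡ (ρ , t)
    via (p , ρ≡) = S-≡ {ρ = corner (extension (toParam (ρ , t)))} {ρ}
                       (sym (trans ρ≡ (cong (λ p → corner (extension p)) (sym toParam≡p))))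
      where
      toParam≡p : toParam (ρ , t) ≡ p
      toParam≡p = trans (cong decode ρ≡) (decode-extension p)

  S-τ₁↔Param : S d c r τ₁ ↔ Param d c r
  S-τ₁↔Param = mk↔ₛ′ toParam fromParam decode-extension fromParam-toParam

record RightInverseOn (n : ℕ) (f g : ℕ → ℕ) : Set where
  field
    g-bounded : ∀ i → i < n → g i < n
    f∘g       : ∀ i → i < n → f (g i) ≡ i

-- The positions of an occurrence in g, read as values of f, form an occurrence in f of the
-- inverse pattern: 123 is an involution, 231 and 312 are inverse to each other.
module _ {n f g} (inv : RightInverseOn n f g) where
  open RightInverseOn inv

  private
    f∘g-< : ∀ {i i′} → i < n → i′ < n → i < i′ → f (g i) < f (g i′)
    f∘g-< {i} {i′} i<n i′<n = subst₂ _<_ (sym (f∘g i i<n)) (sym (f∘g i′ i′<n))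

  Occurrence123-inverse : Occurrence n g Order123 → Occurrence n f Order123
  Occurrence123-inverse (occurrence i₀<i₁ i₁<i₂ i₂<n (v₀<v₁ , v₁<v₂)) =
    occurrence v₀<v₁ v₁<v₂ (g-bounded _ i₂<n) (f∘g-< i₀<n i₁<n i₀<i₁ , f∘g-< i₁<n i₂<n i₁<i₂)
    where i₁<n = <-trans i₁<i₂ i₂<n ; i₀<n = <-trans i₀<i₁ i₁<n

  Occurrence231-inverse : Occurrence n g Order231 → Occurrence n f Order312
  Occurrence231-inverse (occurrence i₀<i₁ i₁<i₂ i₂<n (v₂<v₀ , v₀<v₁)) =
    occurrence v₂<v₀ v₀<v₁ (g-bounded _ i₁<n) (f∘g-< i₀<n i₁<n i₀<i₁ , f∘g-< i₁<n i₂<n i₁<i₂)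
    where i₁<n = <-trans i₁<i₂ i₂<n ; i₀<n = <-trans i₀<i₁ i₁<n

  Occurrence312-inverse : Occurrence n g Order312 → Occurrence n f Order231
  Occurrence312-inverse (occurrence i₀<i₁ i₁<i₂ i₂<n (v₁<v₂ , v₂<v₀)) =
    occurrence v₁<v₂ v₂<v₀ (g-bounded _ i₀<n) (f∘g-< i₀<n i₁<n i₀<i₁ , f∘g-< i₁<n i₂<n i₁<i₂)
    where i₁<n = <-trans i₁<i₂ i₂<n ; i₀<n = <-trans i₀<i₁ i₁<n

Occurrence-cong : ∀ {n n′ s s′ Order} → n′ ≡ n → (∀ i → i < n → s′ i ≡ s i) → Occurrence n′ s′ Order → Occurrence n s Order
Occurrence-cong {Order = Order} refl s′≗s (occurrence i₀<i₁ i₁<i₂ i₂<n order) =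
  occurrence i₀<i₁ i₁<i₂ i₂<n
    (subst₂ (λ x yz → Order x (proj₁ yz) (proj₂ yz)) (s′≗s _ i₀<n) (cong₂ _,_ (s′≗s _ i₁<n) (s′≗s _ i₂<n)) order)
  where i₁<n = <-trans i₁<i₂ i₂<n ; i₀<n = <-trans i₀<i₁ i₁<n

-- d + c + r and d + r + c differ definitionally, so the inverse of σ is rebuilt at the length
-- that S d r c expects.
module InverseExtension (d c r : ℕ) (σ : Vec (Fin (d + c + r)) (d + c + r)) (σ-perm : IsPerm σ) where
  private
    n = d + c + r
    n′ = d + r + c
    n≡n′ = d+c+r≡d+r+c d c r
    σ⁻¹ = inverse σ σ-perm

  inverse′-bounded : ∀ i → i < n′ → at σ⁻¹ i < n′
  inverse′-bounded i i<n′ = subst (at σ⁻¹ i <_) n≡n′ (at<n σ⁻¹ (subst (i <_) (sym n≡n′) i<n′))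

  inverse′ : Vec (Fin n′) n′
  inverse′ = fromFunction n′ (at σ⁻¹) inverse′-bounded

  at-inverse′ : ∀ i → i < n → at inverse′ i ≡ at σ⁻¹ i
  at-inverse′ i i<n = at-fromFunction n′ (at σ⁻¹) inverse′-bounded i (subst (i <_) n≡n′ i<n)

  inverse′-RightInverseOn : RightInverseOn n (at σ) (at inverse′)
  inverse′-RightInverseOn = record
    { g-bounded = λ i i<n → subst (at inverse′ i <_) (sym n≡n′) (at<n inverse′ (subst (i <_) n≡n′ i<n))
    ; f∘g       = λ i i<n → trans (cong (at σ) (at-inverse′ i i<n)) (at-inverse-right σ σ-perm i<n)
    }

  private
    toℕ<n : ∀ (x : Fin n′) → toℕ x < n
    toℕ<n x = subst (toℕ x <_) (sym n≡n′) (FinP.toℕ<n x)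

  inverse′-IsPerm : IsPerm inverse′
  inverse′-IsPerm a b inv-a≡inv-b = FinP.toℕ-injective (begin
    toℕ a                          ≡⟨ sym (at-inverse-right σ σ-perm (toℕ<n a)) ⟩
    at σ (at σ⁻¹ (toℕ a))          ≡⟨ cong (at σ) (sym (at-inverse′ _ (toℕ<n a))) ⟩
    at σ (at inverse′ (toℕ a))     ≡⟨ cong (at σ) (trans (at-toℕ inverse′ a) (trans (cong toℕ inv-a≡inv-b) (sym (at-toℕ inverse′ b)))) ⟩
    at σ (at inverse′ (toℕ b))     ≡⟨ cong (at σ) (at-inverse′ _ (toℕ<n b)) ⟩
    at σ (at σ⁻¹ (toℕ b))          ≡⟨ at-inverse-right σ σ-perm (toℕ<n b) ⟩
    toℕ b                          ∎)
    where open ≡-Reasoning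

  inverse′-LowerRowsInCornerColumns : Corner.LowerRowsInCornerColumns d c r (at σ) →
                                      Corner.LowerRowsInCornerColumns d r c (at inverse′)
  inverse′-LowerRowsInCornerColumns lower i d+c≤i i<n′ with d + r ℕ.≤? at inverse′ i
  ... | no d+r≰σ⁻¹i = ≰⇒> d+r≰σ⁻¹i
  ... | yes d+r≤σ⁻¹i = contradiction d+c≤i (<⇒≱ (subst (_< d + c) (RightInverseOn.f∘g inverse′-RightInverseOn i i<n)
                         (lower (at inverse′ i) d+r≤σ⁻¹i (RightInverseOn.g-bounded inverse′-RightInverseOn i i<n))))
    where
    i<n : i < n
    i<n = subst (i <_) (sym n≡n′) i<n′

  corner-inverse′ : Corner.corner d r c inverse′ ≡ transpose (Corner.corner d c r σ)
  corner-inverse′ = begin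
    Corner.corner d r c inverse′
      ≡⟨ Corner.corner-tabulate d r c inverse′ inverse′-IsPerm ⟩
    tabulate (λ a → tabulate λ b → ⌊ lookup inverse′ (Corner.rowEmbed d r c a) F.≟ Corner.colEmbed d r c b ⌋)
      ≡⟨ VecP.tabulate-cong (λ a → VecP.tabulate-cong (λ b → dot≡ a b)) ⟩
    tabulate (λ a → tabulate λ b → ⌊ lookup σ (Corner.rowEmbed d c r b) F.≟ Corner.colEmbed d c r a ⌋)
      ≡⟨ sym (transpose-tabulate (λ b a → ⌊ lookup σ (Corner.rowEmbed d c r b) F.≟ Corner.colEmbed d c r a ⌋)) ⟩
    transpose (tabulate (λ b → tabulate λ a → ⌊ lookup σ (Corner.rowEmbed d c r b) F.≟ Corner.colEmbed d c r a ⌋))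
      ≡⟨ cong transpose (sym (Corner.corner-tabulate d c r σ σ-perm)) ⟩
    transpose (Corner.corner d c r σ) ∎
    where
    open ≡-Reasoning
    dot≡ : ∀ a b → ⌊ lookup inverse′ (Corner.rowEmbed d r c a) F.≟ Corner.colEmbed d r c b ⌋
                 ≡ ⌊ lookup σ (Corner.rowEmbed d c r b) F.≟ Corner.colEmbed d c r a ⌋
    dot≡ a b = begin
      ⌊ lookup inverse′ (Corner.rowEmbed d r c a) F.≟ Corner.colEmbed d r c b ⌋
        ≡⟨ ⌊≟⌋-toℕ _ _ ⟩
      ⌊ toℕ (lookup inverse′ (Corner.rowEmbed d r c a)) ℕ.≟ toℕ (Corner.colEmbed d r c b) ⌋
        ≡⟨ cong₂ (λ x y → ⌊ x ℕ.≟ y ⌋) (trans (Corner.toℕ-σ-rowEmbed d r c inverse′ inverse′-IsPerm a) (at-inverse′ _ a<n))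
                                        (FinP.toℕ-inject≤ b _) ⟩
      ⌊ at σ⁻¹ (toℕ a) ℕ.≟ toℕ b ⌋
        ≡⟨ ⌊⌋-⇔ (at σ⁻¹ (toℕ a) ℕ.≟ toℕ b) (at σ (toℕ b) ℕ.≟ toℕ a)
               (λ σ⁻¹a≡b → trans (cong (at σ) (sym σ⁻¹a≡b)) (at-inverse-right σ σ-perm a<n))
               (λ σb≡a → trans (cong (at σ⁻¹) (sym σb≡a)) (at-inverse-left σ σ-perm b<n)) ⟩
      ⌊ at σ (toℕ b) ℕ.≟ toℕ a ⌋
        ≡⟨ sym (cong₂ (λ x y → ⌊ x ℕ.≟ y ⌋) (Corner.toℕ-σ-rowEmbed d c r σ σ-perm b) (FinP.toℕ-inject≤ a _)) ⟩
      ⌊ toℕ (lookup σ (Corner.rowEmbed d c r b)) ℕ.≟ toℕ (Corner.colEmbed d c r a) ⌋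
        ≡⟨ sym (⌊≟⌋-toℕ _ _) ⟩
      ⌊ lookup σ (Corner.rowEmbed d c r b) F.≟ Corner.colEmbed d c r a ⌋ ∎
      where
      a<n : toℕ a < n
      a<n = <-≤-trans (FinP.toℕ<n a) (m≤m+n (d + c) r)
      b<n : toℕ b < n
      b<n = <-≤-trans (FinP.toℕ<n b) (rows≤ d c r)

  private
    occurrence-in-σ : ∀ {Order} → Occurrence n′ (at inverse′) Order → Occurrence n (at inverse′) Order
    occurrence-in-σ = Occurrence-cong (sym n≡n′) (λ _ _ → refl)

  inverse′-Avoids-τ₁ : Avoids σ τ₂ → Avoids inverse′ τ₁
  inverse′-Avoids-τ₁ (avoids123 ∷ avoids312 ∷ []) =
      (λ c → avoids123 (Occurrence123⇒Contains σ (Occurrence123-inverse inverse′-RightInverseOn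
                          (occurrence-in-σ (Contains⇒Occurrence123 inverse′ c)))))
    ∷ (λ c → avoids312 (Occurrence312⇒Contains σ (Occurrence231-inverse inverse′-RightInverseOn
                          (occurrence-in-σ (Contains⇒Occurrence231 inverse′ c)))))
    ∷ []

  inverse′-Avoids-τ₂ : Avoids σ τ₁ → Avoids inverse′ τ₂
  inverse′-Avoids-τ₂ (avoids123 ∷ avoids231 ∷ []) =
      (λ c → avoids123 (Occurrence123⇒Contains σ (Occurrence123-inverse inverse′-RightInverseOn
                          (occurrence-in-σ (Contains⇒Occurrence123 inverse′ c)))))
    ∷ (λ c → avoids231 (Occurrence231⇒Contains σ (Occurrence312-inverse inverse′-RightInverseOn
                          (occurrence-in-σ (Contains⇒Occurrence312 inverse′ c)))))
    ∷ []

transpose-InSτ : ∀ d c r {τ τ′} ρ →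
  (∀ σ σ-perm → Avoids σ τ → Avoids (InverseExtension.inverse′ d c r σ σ-perm) τ′) →
  InSτ d c r τ ρ → InSτ d r c τ′ (transpose ρ)
transpose-InSτ d c r ρ transfer (ρ∈S , σ , σ-perm , σ-extends , σ-avoids) =
  subst (IsInS d r c) corner≡transpose
    (Corner.LowerRowsInCornerColumns⇒IsInS d r c inverse′ inverse′-IsPerm (inverse′-LowerRowsInCornerColumns
      (Corner.IsInS⇒LowerRowsInCornerColumns d c r σ σ-perm (subst (IsInS d c r) (sym σ-extends) ρ∈S)))) ,
  inverse′ , inverse′-IsPerm , corner≡transpose , transfer σ σ-perm σ-avoids
  where
  open InverseExtension d c r σ σ-perm
  corner≡transpose : Corner.corner d r c inverse′ ≡ transpose ρ
  corner≡transpose = trans corner-inverse′ (cong transpose σ-extends)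

S-τ₂↔S-τ₁-transposed : ∀ d c r → S d c r τ₂ ↔ S d r c τ₁
S-τ₂↔S-τ₁-transposed d c r = mk↔ₛ′ to from to∘from from∘to
  where
  to : S d c r τ₂ → S d r c τ₁
  to (ρ , t) = transpose ρ , fromWitness {a? = InSτ? d r c τ₁ (transpose ρ)}
    (transpose-InSτ d c r ρ (InverseExtension.inverse′-Avoids-τ₁ d c r) (toWitness {a? = InSτ? d c r τ₂ ρ} t))
  from : S d r c τ₁ → S d c r τ₂
  from (ρ , t) = transpose ρ , fromWitness {a? = InSτ? d c r τ₂ (transpose ρ)}
    (transpose-InSτ d r c ρ (InverseExtension.inverse′-Avoids-τ₂ d r c) (toWitness {a? = InSτ? d r c τ₁ ρ} t))
  to∘from : ∀ x → to (from x) ≡ x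
  to∘from (ρ , t) = S-≡ {ρ = transpose (transpose ρ)} {ρ} (transpose-involutive ρ)
  from∘to : ∀ x → from (to x) ≡ x
  from∘to (ρ , t) = S-≡ {ρ = transpose (transpose ρ)} {ρ} (transpose-involutive ρ)

S-τ₁-symmetric : ∀ d c r → S d c r τ₁ ↔ S d r c τ₁
S-τ₁-symmetric d c r =
  ↔-trans (ParamBijection.S-τ₁↔Param d c r)
  (↔-trans (mk↔ₛ′ swapParam swapParam swapParam-involutive swapParam-involutive)
           (↔-sym (ParamBijection.S-τ₁↔Param d r c)))

proposition5p1 : (∀ d c r → S d c r τ₁ ↔ S d c r τ₂)
    × (∀ d c r → S d c r τ₁ ↔ S d r c τ₁)
    × (∀ d c r → S d c r τ₂ ↔ S d r c τ₂)
proposition5p1 =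
  (λ d c r → ↔-trans (S-τ₁-symmetric d c r) (↔-sym (S-τ₂↔S-τ₁-transposed d c r))) ,
  S-τ₁-symmetric ,
  (λ d c r → ↔-trans (S-τ₂↔S-τ₁-transposed d c r) (↔-trans (S-τ₁-symmetric d r c) (↔-sym (S-τ₂↔S-τ₁-transposed d r c))))
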